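{- Let $f$ be an $n$-ary function symbol and $\vec E=E_1,\ldots,E_k$ a primitive-recursive construction of $f$. Then $\mathbf{CLA2}\vdash \vec E\mathrel{\bullet\!\!- }\sqcap x_1\ldots\sqcap x_n\sqcup y\,\bigl(f(x_1,\ldots,x_n)=y\bigr)$.
   Context: Language: first-order with variables, all natural-number constants, infinitely many $n$-ary predicate and function symbols for each $n$, the logical predicate $=$, connectives $\top,\bot,\neg$ (on atoms only; otherwise $\neg$ and $\to$ are abbreviations), $\wedge,\vee$, choice connectives $\sqcap,\sqcup$, blind quantifiers $\forall,\exists$ and choice quantifiers $\sqcap x,\sqcup x$; no formula or sequent has both free and bound occurrences of the same variable. The function symbols $'$ (unary, written $t'$), $+$, $\times$ and the constant $0$ have special status. A sequent is $E_1,\ldots,E_n\mathrel{\bullet\!\!- }F$ ($n\ge0$). $\mathbf{CL12}$: a surface occurrence is one not in the scope of any choice operator; elementary formulas contain no choice operators; $\|F\|$ replaces $\sqcup$- and $\sqcup x$-subformulas by $\bot$ and $\sqcap$- and $\sqcap x$-subformulas by $\top$; a sequent $G_1..G_n\mathrel{\bullet\!\!- }F$ is stable iff $\|G_1\|\wedge\ldots\wedge\|G_n\|\to\|F\|$ is valid in classical first-order logic with $=$ as identity. $F[E]$ is $F$ with a fixed surface occurrence of $E$, and $F[H]$ replaces it by $H$. Rules ($i\in\{0,1\}$; $t$ a constant or a variable with no bound occurrences in the premise; $\vec G,\vec K$ lists of formulas): $\sqcup$-Choose: $\vec G\mathrel{\bullet\!\!- }F[H_i]$ / $\vec G\mathrel{\bullet\!\!-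 }F[H_0\sqcup H_1]$; $\sqcap$-Choose: $\vec G,E[H_i],\vec K\mathrel{\bullet\!\!- }F$ / $\vec G,E[H_0\sqcap H_1],\vec K\mathrel{\bullet\!\!- }F$; $\sqcap$x-Choose: $\vec G,E[H(t)],\vec K\mathrel{\bullet\!\!- }F$ / $\vec G,E[\sqcap xH(x)],\vec K\mathrel{\bullet\!\!- }F$; $\sqcup$x-Choose: $\vec G\mathrel{\bullet\!\!- }F[H(t)]$ / $\vec G\mathrel{\bullet\!\!- }F[\sqcup xH(x)]$; Replicate: $\vec G,E,\vec K,E\mathrel{\bullet\!\!- }F$ / $\vec G,E,\vec K\mathrel{\bullet\!\!- }F$; Wait: from $X_1..X_n$ ($n\ge0$) infer $Y$ if $Y$ is stable and: when $Y$ is $\vec G\mathrel{\bullet\!\!- }F[H_0\sqcap H_1]$, both $\vec G\mathrel{\bullet\!\!- }F[H_j]$ ($j=0,1$) are among the $X_l$; when $Y$ is $\vec G,E[H_0\sqcup H_1],\vec K\mathrel{\bullet\!\!- }F$, both $\vec G,E[H_j],\vec K\mathrel{\bullet\!\!- }F$ are among them; when $Y$ is $\vec G\mathrel{\bullet\!\!- }F[\sqcap xH(x)]$, $\vec G\mathrel{\bullet\!\!- }F[H(y)]$ is among them for some variable $y$ not in $Y$; when $Y$ is $\vec G,E[\sqcup xH(x)],\vec K\mathrel{\bullet\!\!- }F$, $\vec G,E[H(y)],\vec K\mathrel{\bullet\!\!- }F$ is among them for some $y$ not in $Y$. A proof is a sequence of sequents each following from earlier ones by a rule. $\mathbf{CLA2}$: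 a natural deduction system over the full language above. Axioms (premise-free rules): the $\forall$-closures of $0\neq x'$; $x'=y'\to x=y$; $x+0=x$; $x+y'=(x+y)'$; $x\times0=0$; $x\times y'=(x\times y)+x$; $\sqcap x\sqcup y(y=x')$; $F(0)\wedge\forall x(F(x)\to F(x'))\to\forall xF(x)$ for every elementary $F(x)$. A deduction is a sequence of steps, each a formula or a nested subdeduction with its own hypotheses; premises of a step must be earlier steps of the current or enclosing (sub)deductions or entire earlier subdeductions (not steps inside closed subdeductions). Rules: LC: from $G_1..G_n$ ($n\ge0$) infer $F$ when $\mathbf{CL12}\vdash G_1,\ldots,G_n\mathrel{\bullet\!\!- }F$; CI: from $F(0)$ and a subdeduction with the single hypothesis $F(x)$ whose last step is $F(x')$, infer $\sqcap xF(x)$, where $x$ does not occur anywhere earlier in the proof. $\mathbf{CLA2}\vdash E_1,\ldots,E_n\mathrel{\bullet\!\!- }F$ means there is a deduction of $F$ from the hypotheses $E_1..E_n$. Primitive-recursive constructions: for a function symbol $f$ of the indicated arity, an absolute primitive-recursive definition of $f$ is a formula of one of the forms (I) $\forall x(f(x)=x')$; (II) $\forall x_1\ldots\forall x_n(f(x_1,\ldots,x_n)=0)$; (III) $\forall x_1\ldots\forall x_n(f(x_1,\ldots,x_n)=x_i)$ for some $i\in\{1..n\}$. A relative primitive-recursive definition of $f$ is a formula of the form (IV) $\forall x_1\ldots\forall x_n\bigl(f(x_1,\ldots,x_n)=g(h_1(x_1,\ldots,x_n),\ldots,h_m(x_1,\ldots,x_n))\bigr)$ (defining $f$ in terms of $g,h_1..h_m$)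 or (V) $\forall x_2\ldots\forall x_n\bigl(f(0,x_2,\ldots,x_n)=g(x_2,\ldots,x_n)\bigr)\wedge\forall x_1\forall x_2\ldots\forall x_n\bigl(f(x_1',x_2,\ldots,x_n)=h(x_1,f(x_1,x_2,\ldots,x_n),x_2,\ldots,x_n)\bigr)$ (defining $f$ in terms of $g,h$). A primitive-recursive construction of $f$ is a sequence $E_1..E_k$ of formulas where each $E_i$ is a primitive-recursive definition of some function symbol $g_i$, the $g_i$ are pairwise distinct, $g_k=f$, and each $E_i$ is either absolute or relative in terms of some $g_j$ with $j<i$. -}

module Defs where

open import Data.Nat using (ℕ; zero; suc; _≡ᵇ_; _<_)
open import Data.Bool using (Bool; true; false; _∨_; not; T; if_then_else_)
open import Data.Fin using (Fin; toℕ; fromℕ)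
open import Data.Vec using (Vec; []; _∷_; lookup)
import Data.Vec as V
open import Data.List using (List; []; _∷_; _++_; reverse)
open import Data.Bool.ListAction using (any)
import Data.List as L
open import Data.List.Relation.Unary.All using (All)
open import Data.List.Membership.Propositional using (_∈_)
open import Data.Product using (Σ; ∃; _×_; _,_)
open import Data.Sum using (_⊎_)
open import Data.Unit using (⊤)
open import Data.Unit.Polymorphic using () renaming (⊤ to ⊤₁)
open import Data.Empty using (⊥)
open import Relation.Nullary using (¬_)
open import Relation.Binary.PropositionalEquality using (_≡_; _≢_)

Var : Set
Var = ℕ

data FunSym : ℕ → Set where
  succ  : FunSym 1
  plus  : FunSym 2
  times : FunSym 2
  gen   : (n i : ℕ) → FunSym n

Sym : Set
Sym = Σ ℕ FunSym

-- Terms: variables, natural-number constants (con 0 is the special 0),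
-- and applications of function symbols.
data Term : Set where
  var : Var → Term
  con : ℕ → Term
  app : ∀ {n} → FunSym n → Vec Term n → Term

-- Formulas.  Negation only on atoms (natom, neq); predicate symbols are
-- the  n-ary  symbols  P(n,i).
data Formula : Set where
  ⊤' ⊥'         : Formula
  atom natom    : (n i : ℕ) → Vec Term n → Formula
  eq neq        : Term → Term → Formula
  _∧'_ _∨'_     : Formula → Formula → Formula   -- blind conjunction / disjunction
  _⊓_ _⊔_       : Formula → Formula → Formula   -- choice conjunction / disjunction
  all ex        : Var → Formula → Formula       -- blind ∀ , ∃
  call cex      : Var → Formula → Formula       -- choice ⊓x , ⊔x

infixr 6 _∧'_ _⊓_
infixr 5 _∨'_ _⊔_

S : Term → Term
S t = app succ (t ∷ [])

neg : Formula → Formula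
neg ⊤' = ⊥'
neg ⊥' = ⊤'
neg (atom n i ts) = natom n i ts
neg (natom n i ts) = atom n i ts
neg (eq s t) = neq s t
neg (neq s t) = eq s t
neg (A ∧' B) = neg A ∨' neg B
neg (A ∨' B) = neg A ∧' neg B
neg (A ⊓ B) = neg A ⊔ neg B
neg (A ⊔ B) = neg A ⊓ neg B
neg (all x A) = ex x (neg A)
neg (ex x A) = all x (neg A)
neg (call x A) = cex x (neg A)
neg (cex x A) = call x (neg A)

_⇒_ : Formula → Formula → Formula
A ⇒ B = neg A ∨' B

infixr 4 _⇒_

mutual
  occT : Var → Term → Bool
  occT x (var y) = x ≡ᵇ y
  occT x (con c) = false
  occT x (app f ts) = occTs x ts

  occTs : ∀ {n} → Var → Vec Term n → Bool
  occTs x [] = false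
  occTs x (t ∷ ts) = occT x t ∨ occTs x ts

mutual
  substT : Var → Term → Term → Term
  substT x t (var y) = if x ≡ᵇ y then t else var y
  substT x t (con c) = con c
  substT x t (app f ts) = app f (substTs x t ts)

  substTs : ∀ {n} → Var → Term → Vec Term n → Vec Term n
  substTs x t [] = []
  substTs x t (s ∷ ss) = substT x t s ∷ substTs x t ss

freeF : Var → Formula → Bool
freeF x ⊤' = false
freeF x ⊥' = false
freeF x (atom n i ts) = occTs x ts
freeF x (natom n i ts) = occTs x ts
freeF x (eq s t) = occT x s ∨ occT x t
freeF x (neq s t) = occT x s ∨ occT x t
freeF x (A ∧' B) = freeF x A ∨ freeF x B
freeF x (A ∨' B) = freeF x A ∨ freeF x B
freeF x (A ⊓ B) = freeF x A ∨ freeF x B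
freeF x (A ⊔ B) = freeF x A ∨ freeF x B
freeF x (all y A) = if x ≡ᵇ y then false else freeF x A
freeF x (ex y A) = if x ≡ᵇ y then false else freeF x A
freeF x (call y A) = if x ≡ᵇ y then false else freeF x A
freeF x (cex y A) = if x ≡ᵇ y then false else freeF x A

boundF : Var → Formula → Bool
boundF x ⊤' = false
boundF x ⊥' = false
boundF x (atom n i ts) = false
boundF x (natom n i ts) = false
boundF x (eq s t) = false
boundF x (neq s t) = false
boundF x (A ∧' B) = boundF x A ∨ boundF x B
boundF x (A ∨' B) = boundF x A ∨ boundF x B
boundF x (A ⊓ B) = boundF x A ∨ boundF x B
boundF x (A ⊔ B) = boundF x A ∨ boundF x B
boundF x (all y A) = (x ≡ᵇ y) ∨ boundF x A
boundF x (ex y A) = (x ≡ᵇ y) ∨ boundF x A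
boundF x (call y A) = (x ≡ᵇ y) ∨ boundF x A
boundF x (cex y A) = (x ≡ᵇ y) ∨ boundF x A

occF : Var → Formula → Bool
occF x A = freeF x A ∨ boundF x A

substF : Var → Term → Formula → Formula
substF x t ⊤' = ⊤'
substF x t ⊥' = ⊥'
substF x t (atom n i ts) = atom n i (substTs x t ts)
substF x t (natom n i ts) = natom n i (substTs x t ts)
substF x t (eq a b) = eq (substT x t a) (substT x t b)
substF x t (neq a b) = neq (substT x t a) (substT x t b)
substF x t (A ∧' B) = substF x t A ∧' substF x t B
substF x t (A ∨' B) = substF x t A ∨' substF x t B
substF x t (A ⊓ B) = substF x t A ⊓ substF x t B
substF x t (A ⊔ B) = substF x t A ⊔ substF x t B
substF x t (all y A) = all y (if x ≡ᵇ y then A else substF x t A)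
substF x t (ex y A) = ex y (if x ≡ᵇ y then A else substF x t A)
substF x t (call y A) = call y (if x ≡ᵇ y then A else substF x t A)
substF x t (cex y A) = cex y (if x ≡ᵇ y then A else substF x t A)

elementary : Formula → Bool
elementary (A ∧' B) = if elementary A then elementary B else false
elementary (A ∨' B) = if elementary A then elementary B else false
elementary (A ⊓ B) = false
elementary (A ⊔ B) = false
elementary (all y A) = elementary A
elementary (ex y A) = elementary A
elementary (call y A) = false
elementary (cex y A) = false
elementary _ = true

norm : Formula → Formula
norm (A ∧' B) = norm A ∧' norm B
norm (A ∨' B) = norm A ∨' norm B
norm (A ⊓ B) = ⊤'
norm (A ⊔ B) = ⊥'
norm (all y A) = all y (norm A)
norm (ex y A) = ex y (norm A)
norm (call y A) = ⊤'
norm (cex y A) = ⊥'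
norm A = A

WFf : Formula → Set
WFf A = ∀ x → T (freeF x A) → T (boundF x A) → ⊥

data Sequent : Set where
  _•-_ : List Formula → Formula → Sequent

infix 3 _•-_

freeS boundS occS : Var → Sequent → Bool
freeS x (Gs •- F) = any (freeF x) (F ∷ Gs)
boundS x (Gs •- F) = any (boundF x) (F ∷ Gs)
occS x (Gs •- F) = any (occF x) (F ∷ Gs)

WFs : Sequent → Set
WFs Y = ∀ x → T (freeS x Y) → T (boundS x Y) → ⊥

-- surface contexts F[·]: the hole is not in the scope of a choice operator
data SCtx : Set where
  hole       : SCtx
  _∧ₗ_ _∨ₗ_  : SCtx → Formula → SCtx
  _∧ᵣ_ _∨ᵣ_  : Formula → SCtx → SCtx
  allC exC   : Var → SCtx → SCtx

plug : SCtx → Formula → Formula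
plug hole E = E
plug (c ∧ₗ B) E = plug c E ∧' B
plug (c ∨ₗ B) E = plug c E ∨' B
plug (A ∧ᵣ c) E = A ∧' plug c E
plug (A ∨ᵣ c) E = A ∨' plug c E
plug (allC x c) E = all x (plug c E)
plug (exC x c) E = ex x (plug c E)

record Structure : Set₁ where
  field
    Dom  : Set
    conI : ℕ → Dom
    funI : ∀ {n} → FunSym n → Vec Dom n → Dom
    relI : (n i : ℕ) → Vec Dom n → Set

module Semantics (M : Structure) where
  open Structure M

  Assignment : Set
  Assignment = Var → Dom

  update : Assignment → Var → Dom → Assignment
  update ρ x d y = if x ≡ᵇ y then d else ρ y

  mutual
    evalT : Assignment → Term → Dom
    evalT ρ (var x) = ρ x
    evalT ρ (con c) = conI c
    evalT ρ (app f ts) = funI f (evalTs ρ ts)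

    evalTs : ∀ {n} → Assignment → Vec Term n → Vec Dom n
    evalTs ρ [] = []
    evalTs ρ (t ∷ ts) = evalT ρ t ∷ evalTs ρ ts

  -- Classical (Tarskian) truth, rendered constructively via the
  -- Gödel–Gentzen negative translation (classically equivalent to
  -- ordinary truth).  Choice operators never occur in ‖F‖.
  Sat : Assignment → Formula → Set
  Sat ρ ⊤' = ⊤
  Sat ρ ⊥' = ⊥
  Sat ρ (atom n i ts) = ¬ ¬ relI n i (evalTs ρ ts)
  Sat ρ (natom n i ts) = ¬ relI n i (evalTs ρ ts)
  Sat ρ (eq s t) = ¬ ¬ (evalT ρ s ≡ evalT ρ t)
  Sat ρ (neq s t) = ¬ (evalT ρ s ≡ evalT ρ t)
  Sat ρ (A ∧' B) = Sat ρ A × Sat ρ B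
  Sat ρ (A ∨' B) = ¬ (¬ Sat ρ A × ¬ Sat ρ B)
  Sat ρ (A ⊓ B) = Sat ρ A × Sat ρ B
  Sat ρ (A ⊔ B) = ¬ (¬ Sat ρ A × ¬ Sat ρ B)
  Sat ρ (all x A) = (d : Dom) → Sat (update ρ x d) A
  Sat ρ (ex x A) = ¬ ((d : Dom) → ¬ Sat (update ρ x d) A)
  Sat ρ (call x A) = (d : Dom) → Sat (update ρ x d) A
  Sat ρ (cex x A) = ¬ ((d : Dom) → ¬ Sat (update ρ x d) A)

Valid : Formula → Set₁
Valid F = (M : Structure) (ρ : Var → Structure.Dom M) → Semantics.Sat M ρ F

conj : List Formula → Formula
conj [] = ⊤'
conj (G ∷ []) = G
conj (G ∷ Gs) = G ∧' conj Gs

Stable : Sequent → Set₁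
Stable (Gs •- F) = Valid (conj (L.map norm Gs) ⇒ norm F)

pick : Bool → Formula → Formula → Formula
pick false H₀ H₁ = H₀
pick true  H₀ H₁ = H₁

GoodTerm : Term → Sequent → Set
GoodTerm t P = (∃ λ c → t ≡ con c) ⊎ (∃ λ y → t ≡ var y × ¬ T (boundS y P))

data CL12 : Sequent → Set₁ where
  ⊔-choose : ∀ {Gs c H₀ H₁} (i : Bool) →
    WFs (Gs •- plug c (H₀ ⊔ H₁)) →
    CL12 (Gs •- plug c (pick i H₀ H₁)) →
    CL12 (Gs •- plug c (H₀ ⊔ H₁))
  ⊓-choose : ∀ {Gs Ks c F H₀ H₁} (i : Bool) →
    WFs (Gs ++ plug c (H₀ ⊓ H₁) ∷ Ks •- F) →
    CL12 (Gs ++ plug c (pick i H₀ H₁) ∷ Ks •- F) →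
    CL12 (Gs ++ plug c (H₀ ⊓ H₁) ∷ Ks •- F)
  ⊓x-choose : ∀ {Gs Ks c F x H} (t : Term) →
    GoodTerm t (Gs ++ plug c (substF x t H) ∷ Ks •- F) →
    WFs (Gs ++ plug c (call x H) ∷ Ks •- F) →
    CL12 (Gs ++ plug c (substF x t H) ∷ Ks •- F) →
    CL12 (Gs ++ plug c (call x H) ∷ Ks •- F)
  ⊔x-choose : ∀ {Gs c x H} (t : Term) →
    GoodTerm t (Gs •- plug c (substF x t H)) →
    WFs (Gs •- plug c (cex x H)) →
    CL12 (Gs •- plug c (substF x t H)) →
    CL12 (Gs •- plug c (cex x H))
  replicate : ∀ {Gs E Ks F} →
    WFs (Gs ++ E ∷ Ks •- F) →
    CL12 (Gs ++ E ∷ Ks ++ E ∷ [] •- F) →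
    CL12 (Gs ++ E ∷ Ks •- F)
  wait : ∀ {Y} →
    WFs Y →
    Stable Y →
    (∀ Gs c H₀ H₁ → Y ≡ (Gs •- plug c (H₀ ⊓ H₁)) →
       CL12 (Gs •- plug c H₀) × CL12 (Gs •- plug c H₁)) →
    (∀ Gs c Ks F H₀ H₁ → Y ≡ (Gs ++ plug c (H₀ ⊔ H₁) ∷ Ks •- F) →
       CL12 (Gs ++ plug c H₀ ∷ Ks •- F) × CL12 (Gs ++ plug c H₁ ∷ Ks •- F)) →
    (∀ Gs c x H → Y ≡ (Gs •- plug c (call x H)) →
       ∃ λ y → ¬ T (occS y Y) × CL12 (Gs •- plug c (substF x (var y) H))) →
    (∀ Gs c Ks F x H → Y ≡ (Gs ++ plug c (cex x H) ∷ Ks •- F) →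
       ∃ λ y → ¬ T (occS y Y) × CL12 (Gs ++ plug c (substF x (var y) H) ∷ Ks •- F)) →
    CL12 Y

close2 : Bool → Var → Var → Formula → Formula
close2 false x y A = all x (all y A)
close2 true  x y A = all y (all x A)

_+ₜ_ _×ₜ_ : Term → Term → Term
s +ₜ t = app plus (s ∷ t ∷ [])
s ×ₜ t = app times (s ∷ t ∷ [])

data Axiom : Formula → Set where
  ax-0≠s : ∀ x → Axiom (all x (neq (con 0) (S (var x))))
  ax-s-inj : ∀ x y b → x ≢ y →
    Axiom (close2 b x y (eq (S (var x)) (S (var y)) ⇒ eq (var x) (var y)))
  ax-+0 : ∀ x → Axiom (all x (eq (var x +ₜ con 0) (var x)))
  ax-+s : ∀ x y b → x ≢ y →
    Axiom (close2 b x y (eq (var x +ₜ S (var y)) (S (var x +ₜ var y))))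
  ax-×0 : ∀ x → Axiom (all x (eq (var x ×ₜ con 0) (con 0)))
  ax-×s : ∀ x y b → x ≢ y →
    Axiom (close2 b x y (eq (var x ×ₜ S (var y)) ((var x ×ₜ var y) +ₜ var x)))
  ax-succ : ∀ x y → x ≢ y → Axiom (call x (cex y (eq (var y) (S (var x)))))
  ax-ind : ∀ x F → T (elementary F) →
    Axiom ((substF x (con 0) F ∧' all x (F ⇒ substF x (S (var x)) F)) ⇒ all x F)

-- A deduction is a list of items: formula steps and nested subdeductions
-- (with their own hypotheses).
data Item : Set where
  step : Formula → Item
  sub  : List Formula → List Item → Item

mutual
  occItem : Var → Item → Bool
  occItem x (step F) = occF x F
  occItem x (sub hs is) = any (occF x) hs ∨ occItems x is

  occItems : Var → List Item → Bool
  occItems x [] = false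
  occItems x (i ∷ is) = occItem x i ∨ occItems x is

Last : ∀ {A : Set} → List A → A → Set
Last xs a = ∃ λ init → xs ≡ init ++ a ∷ []

-- 'prior' is the list (latest first) of everything available so far:
-- hypotheses and earlier steps of the current and enclosing deductions,
-- and earlier *closed* subdeductions as whole blocks.  Together these
-- also constitute everything occurring earlier in the proof text.
data Justified (prior : List Item) : Formula → Set₁ where
  by-axiom : ∀ {F} → Axiom F → Justified prior F
  by-LC : ∀ {F} (Gs : List Formula) →
    All (λ G → step G ∈ prior) Gs →
    CL12 (Gs •- F) →
    Justified prior F
  by-CI : ∀ x H js post pre →
    prior ≡ post ++ sub (H ∷ []) js ∷ pre →
    step (substF x (con 0) H) ∈ prior →
    Last js (step (substF x (S (var x)) H)) →
    All (λ e → ¬ T (occItem x e)) pre →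
    All (λ e → ¬ T (occItem x e)) post →
    Justified prior (call x H)

Checks : List Item → List Item → Set₁
Checks prior [] = ⊤₁
Checks prior (step F ∷ is) =
  WFf F × Justified prior F × Checks (step F ∷ prior) is
Checks prior (sub hs js ∷ is) =
  All WFf hs × Checks (L.map step (reverse hs) ++ prior) js × Checks (sub hs js ∷ prior) is

CLA2⊢ : List Formula → Formula → Set₁
CLA2⊢ Es F = All WFf Es × (∃ λ (is : List Item) →
  Checks (L.map step (reverse Es)) is × Last is (step F))

Distinct : ∀ {A : Set} {n} → Vec A n → Set
Distinct xs = ∀ i j → lookup xs i ≡ lookup xs j → i ≡ j

allVs : ∀ {n} → Vec Var n → Formula → Formula
allVs [] F = F
allVs (x ∷ xs) F = all x (allVs xs F)

callVs : ∀ {n} → Vec Var n → Formula → Formula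
callVs [] F = F
callVs (x ∷ xs) F = call x (callVs xs F)

vars : ∀ {n} → Vec Var n → Vec Term n
vars = V.map var

-- PRDef P g E : E is a primitive-recursive definition of g, which, if
-- relative, is in terms of symbols satisfying P.
data PRDef (P : Sym → Set) : Sym → Formula → Set where
  defI : ∀ (g : FunSym 1) x →
    PRDef P (1 , g) (all x (eq (app g (var x ∷ [])) (S (var x))))
  defII : ∀ {n} (g : FunSym n) (xs : Vec Var n) → Distinct xs →
    PRDef P (n , g) (allVs xs (eq (app g (vars xs)) (con 0)))
  defIII : ∀ {n} (g : FunSym n) (xs : Vec Var n) → Distinct xs → (i : Fin n) →
    PRDef P (n , g) (allVs xs (eq (app g (vars xs)) (var (lookup xs i))))
  defIV : ∀ {n m} (f : FunSym n) (g : FunSym m) (hs : Vec (FunSym n) m)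
    (xs : Vec Var n) → Distinct xs →
    P (m , g) → (∀ j → P (n , lookup hs j)) →
    PRDef P (n , f) (allVs xs (eq (app f (vars xs))
                                  (app g (V.map (λ h → app h (vars xs)) hs))))
  defV : ∀ {n} (f : FunSym (suc n)) (g : FunSym n) (h : FunSym (suc (suc n)))
    (x₁ : Var) (xs : Vec Var n) → Distinct (x₁ ∷ xs) →
    P (n , g) → P (suc (suc n) , h) →
    PRDef P (suc n , f)
      (allVs xs (eq (app f (con 0 ∷ vars xs)) (app g (vars xs)))
       ∧' all x₁ (allVs xs (eq (app f (S (var x₁) ∷ vars xs))
                               (app h (var x₁ ∷ app f (var x₁ ∷ vars xs) ∷ vars xs)))))

-- E₁…E_k is a primitive-recursive construction of f (k ≥ 1, since g_k = f)
record PRConstruction {k} (Es : Vec Formula (suc k)) (f : Sym) : Set where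
  field
    gs       : Vec Sym (suc k)
    distinct : Distinct gs
    lastIsF  : lookup gs (fromℕ k) ≡ f
    defs     : ∀ i → PRDef (λ s → ∃ λ j → toℕ j < toℕ i × lookup gs j ≡ s)
                            (lookup gs i) (lookup Es i)

goal : ∀ {n} → FunSym n → Vec Var n → Var → Formula
goal f xs y = callVs xs (cex y (eq (app f (vars xs)) (var y)))

{-# OPTIONS --safe #-}
module Submission where

-- Following the order of the construction, each definition E_i yields in CLA2 the totality formula
-- ⊓u₁…⊓uₙ ⊔v (g_i(u₁,…,uₙ) = v) of its symbol g_i.  For the schemata (I)–(IV) this is a single LC step from
-- E_i, the totality of the symbols E_i refers to and, for (I), the axiom ⊓x ⊔y (y = x').  For recursion (V)
-- it is CI applied to H(c) = ⊓u ⊔v (f(c, u) = v), where H(0) and the step H(c) ⊢ H(c') are again LC steps.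
-- Every LC step is a CL12 proof of one shape: Wait introduces the goal's ⊓-variables as fresh variables,
-- each hypothesis ⊓p ⊔w (…) is ⊓-chosen at suitable terms and its ⊔-value read off as a fresh variable by
-- Wait, and finally the goal's value is ⊔-chosen; what remains is an elementary sequent, stable because the
-- defining equations classically imply it.  Hypotheses and goals only use variables below a bound Lb, so
-- every variable taken from Lb upwards is fresh.

open import Defs
open import Data.Bool using (Bool; true; false; _∨_; T)
open import Data.Bool.Properties using (T-∨)
open import Data.Bool.ListAction using (any)
open import Data.Empty using (⊥; ⊥-elim)
open import Data.Fin as Fin using (Fin; toℕ; fromℕ; fromℕ<)
import Data.Fin.Properties as Finₚ
open import Data.List as List using (List; []; _∷_; _++_; reverse; _ʳ++_)
open import Data.List.Properties using (++-assoc; ++-ʳ++; ∷-injective)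
open import Data.List.Membership.Propositional using (_∈_; find)
open import Data.List.Membership.Propositional.Properties using (∈-map⁺)
open import Data.List.Relation.Unary.All as All using (All; []; _∷_)
open import Data.List.Relation.Unary.All.Properties as Allₚ using (++⁺)
open import Data.List.Relation.Unary.Any using (here; there)
import Data.List.Relation.Unary.Any.Properties as Anyₚ
open import Data.Nat using (ℕ; zero; suc; _≡ᵇ_; _<_; _≤_; _+_; s≤s)
open import Data.Nat.Properties
open import Data.Product using (Σ; ∃; _×_; _,_; proj₁; proj₂)
open import Data.Sum using (_⊎_; inj₁; inj₂)
open import Data.Unit using (⊤; tt)
open import Data.Vec as Vec using (Vec; []; _∷_; lookup; toList)
import Data.Vec.Properties as Vecₚ
import Data.Vec.Membership.Propositional.Properties as VecMemₚ
import Data.Vec.Relation.Unary.All.Properties as VecAllₚ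
open import Function using (Equivalence)
open import Relation.Nullary using (¬_)
open import Relation.Nullary.Negation using (¬¬-map)
open import Relation.Binary.PropositionalEquality

∨⁻ : ∀ a {b} → T (a ∨ b) → T a ⊎ T b
∨⁻ a = Equivalence.to (T-∨ {a})

∨⁺ˡ : ∀ a b → T a → T (a ∨ b)
∨⁺ˡ a b t = Equivalence.from (T-∨ {a} {b}) (inj₁ t)

∨⁺ʳ : ∀ a b → T b → T (a ∨ b)
∨⁺ʳ a b t = Equivalence.from (T-∨ {a} {b}) (inj₂ t)

T-≡ᵇ : ∀ {x y} → T (x ≡ᵇ y) → x ≡ y
T-≡ᵇ {x} {y} = ≡ᵇ⇒≡ x y

≡ᵇ-≢ : ∀ {x y} → x ≢ y → (x ≡ᵇ y) ≡ false
≡ᵇ-≢ {x} {y} x≢y with x ≡ᵇ y in e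
... | true = ⊥-elim (x≢y (≡ᵇ⇒≡ x y (subst T (sym e) tt)))
... | false = refl

≡ᵇ-refl : ∀ x → (x ≡ᵇ x) ≡ true
≡ᵇ-refl x with x ≡ᵇ x in e
... | true = refl
... | false = ⊥-elim (subst T e (≡⇒≡ᵇ x x refl))

NotIn : ∀ {n} → Var → Vec Var n → Set
NotIn x [] = ⊤
NotIn x (y ∷ ys) = x ≢ y × NotIn x ys

AllDistinct : ∀ {n} → Vec Var n → Set
AllDistinct [] = ⊤
AllDistinct (x ∷ xs) = NotIn x xs × AllDistinct xs

AllBelow : ∀ {n} → ℕ → Vec Var n → Set
AllBelow L [] = ⊤
AllBelow L (y ∷ ys) = y < L × AllBelow L ys

AllBelow-mono : ∀ {n} {a b} (vs : Vec Var n) → a ≤ b → AllBelow a vs → AllBelow b vs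
AllBelow-mono [] le _ = tt
AllBelow-mono (v ∷ vs) le (l , ls) = <-≤-trans l le , AllBelow-mono vs le ls

allBelow⁺ : ∀ {n} B (xs : Vec Var n) → (∀ i → lookup xs i < B) → AllBelow B xs
allBelow⁺ B [] h = tt
allBelow⁺ B (x ∷ xs) h = h Fin.zero , allBelow⁺ B xs (λ i → h (Fin.suc i))

allBelow-notIn : ∀ {n} L (us : Vec Var n) z → AllBelow L us → L ≤ z → NotIn z us
allBelow-notIn L [] z _ _ = tt
allBelow-notIn L (u ∷ us) z (u<L , us<L) L≤z =
  (λ e → <-irrefl (sym e) (<-≤-trans u<L L≤z)) , allBelow-notIn L us z us<L L≤z

notIn⁺ : ∀ {n} x (ys : Vec Var n) → (∀ j → x ≢ lookup ys j) → NotIn x ys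
notIn⁺ x [] h = tt
notIn⁺ x (y ∷ ys) h = h Fin.zero , notIn⁺ x ys (λ j → h (Fin.suc j))

Distinct⇒AllDistinct : ∀ {n} (xs : Vec Var n) → Distinct xs → AllDistinct xs
Distinct⇒AllDistinct [] d = tt
Distinct⇒AllDistinct (x ∷ xs) d =
  notIn⁺ x xs (λ j e → zero≢suc (d Fin.zero (Fin.suc j) e)) ,
  Distinct⇒AllDistinct xs (λ i j e → Finₚ.suc-injective (d (Fin.suc i) (Fin.suc j) e))
  where
  zero≢suc : ∀ {n} {j : Fin n} → Fin.zero {n} ≢ Fin.suc j
  zero≢suc ()

occ-vars-notIn : ∀ x {n} (us : Vec Var n) → T (occTs x (vars us)) → NotIn x us → ⊥
occ-vars-notIn x (u ∷ us) o (x≢u , x∉us) with ∨⁻ (occT x (var u)) o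
... | inj₁ a = x≢u (T-≡ᵇ a)
... | inj₂ b = occ-vars-notIn x us b x∉us

occ-vars-below : ∀ {n} B (us : Vec Var n) x → AllBelow B us → T (occTs x (vars us)) → x < B
occ-vars-below B (u ∷ us) x (u<B , us<B) o with ∨⁻ (occT x (var u)) o
... | inj₁ a rewrite T-≡ᵇ {x} {u} a = u<B
... | inj₂ b = occ-vars-below B us x us<B b

consecVars : ℕ → (n : ℕ) → Vec Var n
consecVars U zero = []
consecVars U (suc n) = U ∷ consecVars (suc U) n

consecVars-below : ∀ U n L → n + U ≤ L → AllBelow L (consecVars U n)
consecVars-below U zero L le = tt
consecVars-below U (suc n) L le =
  ≤-trans (s≤s (m≤n+m U n)) le , consecVars-below (suc U) n L (subst (_≤ L) (sym (+-suc n U)) le)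

consecVars-notIn : ∀ x U n → x < U → NotIn x (consecVars U n)
consecVars-notIn x U zero lt = tt
consecVars-notIn x U (suc n) lt = (λ e → <-irrefl e lt) , consecVars-notIn x (suc U) n (m≤n⇒m≤1+n lt)

consecVars-distinct : ∀ U n → AllDistinct (consecVars U n)
consecVars-distinct U zero = tt
consecVars-distinct U (suc n) = consecVars-notIn U (suc U) n ≤-refl , consecVars-distinct (suc U) n

occ-consecVars : ∀ x U n → T (occTs x (vars (consecVars U n))) → U ≤ x × x < n + U
occ-consecVars x U (suc n) o with ∨⁻ (occT x (var U)) o
... | inj₁ a rewrite T-≡ᵇ {x} {U} a = ≤-refl , s≤s (m≤n+m U n)
... | inj₂ b with occ-consecVars x (suc U) n b
... | l1 , l2 = <⇒≤ l1 , subst (x <_) (+-suc n U) l2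

lookup-consecVars : ∀ U {n} (i : Fin n) → U ≤ lookup (consecVars U n) i × lookup (consecVars U n) i < n + U
lookup-consecVars U {suc n} Fin.zero = ≤-refl , s≤s (m≤n+m U n)
lookup-consecVars U {suc n} (Fin.suc i) with lookup-consecVars (suc U) i
... | a , b = <⇒≤ a , subst (lookup (consecVars (suc U) n) i <_) (+-suc n U) b

-- Substitution

mutual
  occ-substT : ∀ x p t s → T (occT x (substT p t s)) → (T (occT x s) × x ≢ p) ⊎ T (occT x t)
  occ-substT x p t (var y) h with p ≡ᵇ y in e
  ... | true = inj₂ h
  ... | false = inj₁ (h , λ x≡p → subst T e (subst (λ q → T (q ≡ᵇ y)) x≡p h))
  occ-substT x p t (app f ts) h = occ-substTs x p t ts h

  occ-substTs : ∀ {n} x p t (ts : Vec Term n) → T (occTs x (substTs p t ts)) →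
    (T (occTs x ts) × x ≢ p) ⊎ T (occT x t)
  occ-substTs x p t (s ∷ ts) h with ∨⁻ (occT x (substT p t s)) h
  ... | inj₁ a with occ-substT x p t s a
  ... | inj₁ (b , c) = inj₁ (∨⁺ˡ (occT x s) _ b , c)
  ... | inj₂ c = inj₂ c
  occ-substTs x p t (s ∷ ts) h | inj₂ a with occ-substTs x p t ts a
  ... | inj₁ (b , c) = inj₁ (∨⁺ʳ (occT x s) _ b , c)
  ... | inj₂ c = inj₂ c

occTs-++ : ∀ x {a b} (rs : Vec Term a) (ss : Vec Term b) →
  T (occTs x (rs Vec.++ ss)) → T (occTs x rs) ⊎ T (occTs x ss)
occTs-++ x [] ss o = inj₂ o
occTs-++ x (r ∷ rs) ss o with ∨⁻ (occT x r) o
... | inj₁ a = inj₁ (∨⁺ˡ (occT x r) _ a)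
... | inj₂ b with occTs-++ x rs ss b
... | inj₁ c = inj₁ (∨⁺ʳ (occT x r) _ c)
... | inj₂ c = inj₂ c

substT-var-≡ : ∀ x t → substT x t (var x) ≡ t
substT-var-≡ x t rewrite ≡ᵇ-refl x = refl

substT-var-≢ : ∀ x t y → x ≢ y → substT x t (var y) ≡ var y
substT-var-≢ x t y x≢y rewrite ≡ᵇ-≢ x≢y = refl

substTs-vars-notIn : ∀ x t {n} (us : Vec Var n) → NotIn x us → substTs x t (vars us) ≡ vars us
substTs-vars-notIn x t [] _ = refl
substTs-vars-notIn x t (u ∷ us) (x≢u , x∉us) rewrite ≡ᵇ-≢ x≢u = cong (var u ∷_) (substTs-vars-notIn x t us x∉us)

-- Sequential, not simultaneous, substitution.
substMany : ∀ {n} → Vec Var n → Vec Term n → Term → Term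
substMany [] [] s = s
substMany (p ∷ ps) (t ∷ ts) s = substMany ps ts (substT p t s)

Avoids : ∀ {m} → Term → Vec Var m → Set
Avoids t ps = (∃ λ c → t ≡ con c) ⊎ (∃ λ z → t ≡ var z × NotIn z ps)

AllAvoid : ∀ {n m} → Vec Term n → Vec Var m → Set
AllAvoid [] ps = ⊤
AllAvoid (t ∷ ts) ps = Avoids t ps × AllAvoid ts ps

avoids-tail : ∀ {m} t p (ps : Vec Var m) → Avoids t (p ∷ ps) → Avoids t ps
avoids-tail t p ps (inj₁ c) = inj₁ c
avoids-tail t p ps (inj₂ (z , e , _ , z∉ps)) = inj₂ (z , e , z∉ps)

allAvoid-tail : ∀ {n m} (ts : Vec Term n) p (ps : Vec Var m) → AllAvoid ts (p ∷ ps) → AllAvoid ts ps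
allAvoid-tail [] p ps _ = tt
allAvoid-tail (t ∷ ts) p ps (a , as) = avoids-tail t p ps a , allAvoid-tail ts p ps as

allAvoid-consecVars : ∀ {m} U n (ps : Vec Var m) → (∀ z → U ≤ z → NotIn z ps) → AllAvoid (vars (consecVars U n)) ps
allAvoid-consecVars U zero ps h = tt
allAvoid-consecVars U (suc n) ps h =
  inj₂ (U , refl , h U ≤-refl) , allAvoid-consecVars (suc U) n ps (λ z le → h z (<⇒≤ le))

⊓⊔Eq : ∀ {n} → Vec Var n → Var → Term → Term → Formula
⊓⊔Eq ps v s u = callVs ps (cex v (eq s u))

subst-⊓⊔Eq : ∀ {n} x t (ps : Vec Var n) v s u → NotIn x ps → x ≢ v →
  substF x t (⊓⊔Eq ps v s u) ≡ ⊓⊔Eq ps v (substT x t s) (substT x t u)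
subst-⊓⊔Eq x t [] v s u _ x≢v rewrite ≡ᵇ-≢ x≢v = refl
subst-⊓⊔Eq x t (p ∷ ps) v s u (x≢p , x∉ps) x≢v rewrite ≡ᵇ-≢ x≢p =
  cong (call p) (subst-⊓⊔Eq x t ps v s u x∉ps x≢v)

free-⊓⊔Eq : ∀ {n} x (ps : Vec Var n) v s u → T (freeF x (⊓⊔Eq ps v s u)) →
  T (occT x s ∨ occT x u) × NotIn x ps × x ≢ v
free-⊓⊔Eq x [] v s u h with x ≡ᵇ v in e
... | false = h , tt , λ x≡v → subst T e (≡⇒≡ᵇ x v x≡v)
free-⊓⊔Eq x (p ∷ ps) v s u h with x ≡ᵇ p in e
... | false with free-⊓⊔Eq x ps v s u h
... | a , b , c = a , ((λ x≡p → subst T e (≡⇒≡ᵇ x p x≡p)) , b) , c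

bound-⊓⊔Eq : ∀ {n} x (ps : Vec Var n) v s u L → AllBelow L ps → v < L → T (boundF x (⊓⊔Eq ps v s u)) → x < L
bound-⊓⊔Eq x [] v s u L _ v<L h with ∨⁻ (x ≡ᵇ v) h
... | inj₁ t = subst (_< L) (sym (T-≡ᵇ t)) v<L
bound-⊓⊔Eq x (p ∷ ps) v s u L (p<L , ps<L) v<L h with ∨⁻ (x ≡ᵇ p) h
... | inj₁ t = subst (_< L) (sym (T-≡ᵇ t)) p<L
... | inj₂ t = bound-⊓⊔Eq x ps v s u L ps<L v<L t

-- Classical semantics

module Eval (M : Structure) where
  open Structure M
  open Semantics M

  mutual
    ¬sat-neg⇒sat : ∀ ρ A → ¬ Sat ρ (neg A) → Sat ρ A
    ¬sat-neg⇒sat ρ ⊤' h = tt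
    ¬sat-neg⇒sat ρ ⊥' h = h tt
    ¬sat-neg⇒sat ρ (atom n i ts) h = h
    ¬sat-neg⇒sat ρ (natom n i ts) h = λ r → h (λ k → k r)
    ¬sat-neg⇒sat ρ (eq s t) h = h
    ¬sat-neg⇒sat ρ (neq s t) h = λ r → h (λ k → k r)
    ¬sat-neg⇒sat ρ (A ∧' B) h =
      ¬sat-neg⇒sat ρ A (λ a → h (λ p → proj₁ p a)) , ¬sat-neg⇒sat ρ B (λ b → h (λ p → proj₂ p b))
    ¬sat-neg⇒sat ρ (A ∨' B) h = λ p → h (¬sat⇒sat-neg ρ A (proj₁ p) , ¬sat⇒sat-neg ρ B (proj₂ p))
    ¬sat-neg⇒sat ρ (A ⊓ B) h =
      ¬sat-neg⇒sat ρ A (λ a → h (λ p → proj₁ p a)) , ¬sat-neg⇒sat ρ B (λ b → h (λ p → proj₂ p b))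
    ¬sat-neg⇒sat ρ (A ⊔ B) h = λ p → h (¬sat⇒sat-neg ρ A (proj₁ p) , ¬sat⇒sat-neg ρ B (proj₂ p))
    ¬sat-neg⇒sat ρ (all x A) h = λ d → ¬sat-neg⇒sat (update ρ x d) A (λ a → h (λ f → f d a))
    ¬sat-neg⇒sat ρ (ex x A) h = λ f → h (λ d → ¬sat⇒sat-neg (update ρ x d) A (f d))
    ¬sat-neg⇒sat ρ (call x A) h = λ d → ¬sat-neg⇒sat (update ρ x d) A (λ a → h (λ f → f d a))
    ¬sat-neg⇒sat ρ (cex x A) h = λ f → h (λ d → ¬sat⇒sat-neg (update ρ x d) A (f d))

    ¬sat⇒sat-neg : ∀ ρ A → ¬ Sat ρ A → Sat ρ (neg A)
    ¬sat⇒sat-neg ρ ⊤' h = h tt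
    ¬sat⇒sat-neg ρ ⊥' h = tt
    ¬sat⇒sat-neg ρ (atom n i ts) h = λ r → h (λ k → k r)
    ¬sat⇒sat-neg ρ (natom n i ts) h = h
    ¬sat⇒sat-neg ρ (eq s t) h = λ r → h (λ k → k r)
    ¬sat⇒sat-neg ρ (neq s t) h = h
    ¬sat⇒sat-neg ρ (A ∧' B) h = λ p → h (¬sat-neg⇒sat ρ A (proj₁ p) , ¬sat-neg⇒sat ρ B (proj₂ p))
    ¬sat⇒sat-neg ρ (A ∨' B) h =
      ¬sat⇒sat-neg ρ A (λ a → h (λ p → proj₁ p a)) , ¬sat⇒sat-neg ρ B (λ b → h (λ p → proj₂ p b))
    ¬sat⇒sat-neg ρ (A ⊓ B) h = λ p → h (¬sat-neg⇒sat ρ A (proj₁ p) , ¬sat-neg⇒sat ρ B (proj₂ p))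
    ¬sat⇒sat-neg ρ (A ⊔ B) h =
      ¬sat⇒sat-neg ρ A (λ a → h (λ p → proj₁ p a)) , ¬sat⇒sat-neg ρ B (λ b → h (λ p → proj₂ p b))
    ¬sat⇒sat-neg ρ (all x A) h = λ f → h (λ d → ¬sat-neg⇒sat (update ρ x d) A (f d))
    ¬sat⇒sat-neg ρ (ex x A) h = λ d → ¬sat⇒sat-neg (update ρ x d) A (λ a → h (λ f → f d a))
    ¬sat⇒sat-neg ρ (call x A) h = λ f → h (λ d → ¬sat-neg⇒sat (update ρ x d) A (f d))
    ¬sat⇒sat-neg ρ (cex x A) h = λ d → ¬sat⇒sat-neg (update ρ x d) A (λ a → h (λ f → f d a))

  sat-⇒ : ∀ ρ A B → (Sat ρ A → Sat ρ B) → Sat ρ (A ⇒ B)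
  sat-⇒ ρ A B f (¬a , ¬b) = ¬b (f (¬sat-neg⇒sat ρ A ¬a))

  sat-conj⁻ : ∀ ρ Gs → Sat ρ (conj Gs) → All (Sat ρ) Gs
  sat-conj⁻ ρ [] s = []
  sat-conj⁻ ρ (G ∷ []) s = s ∷ []
  sat-conj⁻ ρ (G ∷ G' ∷ Gs) (s , r) = s ∷ sat-conj⁻ ρ (G' ∷ Gs) r

  update-≡ : ∀ ρ p d → update ρ p d p ≡ d
  update-≡ ρ p d rewrite ≡ᵇ-refl p = refl

  update-≢ : ∀ ρ p d x → p ≢ x → update ρ p d x ≡ ρ x
  update-≢ ρ p d x p≢x rewrite ≡ᵇ-≢ p≢x = refl

  mutual
    evalT-substT : ∀ ρ x t s → evalT ρ (substT x t s) ≡ evalT (update ρ x (evalT ρ t)) s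
    evalT-substT ρ x t (var y) with x ≡ᵇ y
    ... | true = refl
    ... | false = refl
    evalT-substT ρ x t (con c) = refl
    evalT-substT ρ x t (app f ts) = cong (funI f) (evalTs-substTs ρ x t ts)

    evalTs-substTs : ∀ {n} ρ x t (ts : Vec Term n) →
      evalTs ρ (substTs x t ts) ≡ evalTs (update ρ x (evalT ρ t)) ts
    evalTs-substTs ρ x t [] = refl
    evalTs-substTs ρ x t (s ∷ ts) = cong₂ _∷_ (evalT-substT ρ x t s) (evalTs-substTs ρ x t ts)

  mutual
    evalT-cong : ∀ ρ ρ' t → (∀ x → T (occT x t) → ρ x ≡ ρ' x) → evalT ρ t ≡ evalT ρ' t
    evalT-cong ρ ρ' (var x) h = h x (subst T (sym (≡ᵇ-refl x)) tt)
    evalT-cong ρ ρ' (con c) h = refl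
    evalT-cong ρ ρ' (app f ts) h = cong (funI f) (evalTs-cong ρ ρ' ts h)

    evalTs-cong : ∀ ρ ρ' {n} (ts : Vec Term n) → (∀ x → T (occTs x ts) → ρ x ≡ ρ' x) →
      evalTs ρ ts ≡ evalTs ρ' ts
    evalTs-cong ρ ρ' [] h = refl
    evalTs-cong ρ ρ' (t ∷ ts) h =
      cong₂ _∷_ (evalT-cong ρ ρ' t (λ x o → h x (∨⁺ˡ (occT x t) _ o)))
                (evalTs-cong ρ ρ' ts (λ x o → h x (∨⁺ʳ (occT x t) _ o)))

  evalTs-++ : ∀ ρ {a b} (rs : Vec Term a) (ss : Vec Term b) →
    evalTs ρ (rs Vec.++ ss) ≡ evalTs ρ rs Vec.++ evalTs ρ ss
  evalTs-++ ρ [] ss = refl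
  evalTs-++ ρ (r ∷ rs) ss = cong (evalT ρ r ∷_) (evalTs-++ ρ rs ss)

  evalTs-vars : ∀ ρ {n} (xs : Vec Var n) → evalTs ρ (vars xs) ≡ Vec.map ρ xs
  evalTs-vars ρ [] = refl
  evalTs-vars ρ (x ∷ xs) = cong (ρ x ∷_) (evalTs-vars ρ xs)

  evalTs-vars-update : ∀ ρ p d {n} (us : Vec Var n) → NotIn p us →
    evalTs (update ρ p d) (vars us) ≡ evalTs ρ (vars us)
  evalTs-vars-update ρ p d [] _ = refl
  evalTs-vars-update ρ p d (u ∷ us) (p≢u , p∉us) =
    cong₂ _∷_ (update-≢ ρ p d u p≢u) (evalTs-vars-update ρ p d us p∉us)

  updateAll : Assignment → ∀ {n} → Vec Var n → Vec Dom n → Assignment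
  updateAll ρ [] [] = ρ
  updateAll ρ (x ∷ xs) (d ∷ ds) = updateAll (update ρ x d) xs ds

  sat-allVs⁻ : ∀ ρ {n} (xs : Vec Var n) A (ds : Vec Dom n) → Sat ρ (allVs xs A) → Sat (updateAll ρ xs ds) A
  sat-allVs⁻ ρ [] A [] s = s
  sat-allVs⁻ ρ (x ∷ xs) A (d ∷ ds) s = sat-allVs⁻ (update ρ x d) xs A ds (s d)

  updateAll-notIn : ∀ ρ {n} (xs : Vec Var n) ds z → NotIn z xs → updateAll ρ xs ds z ≡ ρ z
  updateAll-notIn ρ [] [] z _ = refl
  updateAll-notIn ρ (x ∷ xs) (d ∷ ds) z (z≢x , z∉xs) =
    trans (updateAll-notIn _ xs ds z z∉xs) (update-≢ ρ x d z (λ e → z≢x (sym e)))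

  evalTs-vars-updateAll : ∀ ρ {n} (xs : Vec Var n) ds → AllDistinct xs → evalTs (updateAll ρ xs ds) (vars xs) ≡ ds
  evalTs-vars-updateAll ρ [] [] _ = refl
  evalTs-vars-updateAll ρ (x ∷ xs) (d ∷ ds) (x∉xs , dxs) =
    cong₂ _∷_ (trans (updateAll-notIn _ xs ds x x∉xs) (update-≡ ρ x d)) (evalTs-vars-updateAll _ xs ds dxs)

  updateMany : Assignment → ∀ {n} → Vec Var n → Vec Term n → Assignment
  updateMany ρ [] [] = ρ
  updateMany ρ (p ∷ ps) (t ∷ ts) = update (updateMany ρ ps ts) p (evalT (updateMany ρ ps ts) t)

  evalT-substMany : ∀ ρ {n} (ps : Vec Var n) ts s → evalT ρ (substMany ps ts s) ≡ evalT (updateMany ρ ps ts) s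
  evalT-substMany ρ [] [] s = refl
  evalT-substMany ρ (p ∷ ps) (t ∷ ts) s =
    trans (evalT-substMany ρ ps ts (substT p t s)) (evalT-substT (updateMany ρ ps ts) p t s)

  updateMany-notIn : ∀ ρ {n} (ps : Vec Var n) ts x → NotIn x ps → updateMany ρ ps ts x ≡ ρ x
  updateMany-notIn ρ [] [] x _ = refl
  updateMany-notIn ρ (p ∷ ps) (t ∷ ts) x (x≢p , x∉ps) =
    trans (update-≢ (updateMany ρ ps ts) p _ x (λ e → x≢p (sym e))) (updateMany-notIn ρ ps ts x x∉ps)

  evalT-updateMany-avoids : ∀ ρ {n} (ps : Vec Var n) ts t → Avoids t ps → evalT (updateMany ρ ps ts) t ≡ evalT ρ t
  evalT-updateMany-avoids ρ ps ts t (inj₁ (c , refl)) = refl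
  evalT-updateMany-avoids ρ ps ts t (inj₂ (z , refl , z∉ps)) = updateMany-notIn ρ ps ts z z∉ps

  evalTs-vars-updateMany : ∀ ρ {n} (ps : Vec Var n) ts → AllDistinct ps → AllAvoid ts ps →
    evalTs (updateMany ρ ps ts) (vars ps) ≡ evalTs ρ ts
  evalTs-vars-updateMany ρ [] [] _ _ = refl
  evalTs-vars-updateMany ρ (p ∷ ps) (t ∷ ts) (p∉ps , dps) (a , as) =
    cong₂ _∷_ (trans (update-≡ (updateMany ρ ps ts) p _) (evalT-updateMany-avoids ρ ps ts t (avoids-tail t p ps a)))
              (trans (evalTs-vars-update (updateMany ρ ps ts) p _ ps p∉ps)
                     (evalTs-vars-updateMany ρ ps ts dps (allAvoid-tail ts p ps as)))

  -- The two sides of the equation of  ⊓d₀ ⊓us ⊔v₀ (g(rs, us) = v₀)  instantiated at t₀, ts and then tw.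
  module _ (ρ : Assignment) (d₀ v₀ : Var) (tw : Term) {n} (us : Vec Var n) (t₀ : Term) (ts : Vec Term n)
           (dus : AllDistinct us) (d₀∉us : NotIn d₀ us) (v₀∉us : NotIn v₀ us) (d₀≢v₀ : d₀ ≢ v₀)
           (ts-avoid : AllAvoid ts us) (ts≢v₀ : ∀ x → T (occTs x ts) → x ≢ v₀) where
    private
      ρ' = update ρ v₀ (evalT ρ tw)
      R = updateMany ρ' (d₀ ∷ us) (t₀ ∷ ts)

      R-outside : ∀ x → NotIn x (d₀ ∷ us) → x ≢ v₀ → R x ≡ ρ x
      R-outside x x∉ x≢v₀ = trans (updateMany-notIn ρ' (d₀ ∷ us) (t₀ ∷ ts) x x∉) (update-≢ ρ v₀ _ x (λ e → x≢v₀ (sym e)))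

    evalT-inst-app : ∀ {k} (g : FunSym (k + n)) (rs : Vec Term k) →
      (∀ x → T (occTs x rs) → NotIn x (d₀ ∷ us) × x ≢ v₀) →
      evalT ρ (substT v₀ tw (substMany (d₀ ∷ us) (t₀ ∷ ts) (app g (rs Vec.++ vars us))))
        ≡ funI g (evalTs ρ rs Vec.++ evalTs ρ ts)
    evalT-inst-app g rs hr = begin
      evalT ρ (substT v₀ tw (substMany (d₀ ∷ us) (t₀ ∷ ts) (app g (rs Vec.++ vars us))))
        ≡⟨ evalT-substT ρ v₀ tw (substMany (d₀ ∷ us) (t₀ ∷ ts) (app g (rs Vec.++ vars us))) ⟩
      evalT ρ' (substMany (d₀ ∷ us) (t₀ ∷ ts) (app g (rs Vec.++ vars us)))
        ≡⟨ evalT-substMany ρ' (d₀ ∷ us) (t₀ ∷ ts) (app g (rs Vec.++ vars us)) ⟩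
      funI g (evalTs R (rs Vec.++ vars us))
        ≡⟨ cong (funI g) (evalTs-++ R rs (vars us)) ⟩
      funI g (evalTs R rs Vec.++ evalTs R (vars us))
        ≡⟨ cong (λ a → funI g (a Vec.++ evalTs R (vars us)))
                (evalTs-cong R ρ rs (λ x o → R-outside x (proj₁ (hr x o)) (proj₂ (hr x o)))) ⟩
      funI g (evalTs ρ rs Vec.++ evalTs R (vars us))
        ≡⟨ cong (λ a → funI g (evalTs ρ rs Vec.++ a)) us-values ⟩
      funI g (evalTs ρ rs Vec.++ evalTs ρ ts) ∎
      where
      open ≡-Reasoning
      us-values : evalTs R (vars us) ≡ evalTs ρ ts
      us-values = trans (evalTs-vars-update _ d₀ _ us d₀∉us)
                 (trans (evalTs-vars-updateMany ρ' us ts dus ts-avoid)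
                        (evalTs-cong ρ' ρ ts (λ x o → update-≢ ρ v₀ _ x (λ e → ts≢v₀ x o (sym e)))))

    evalT-inst-var : evalT ρ (substT v₀ tw (substMany (d₀ ∷ us) (t₀ ∷ ts) (var v₀))) ≡ evalT ρ tw
    evalT-inst-var = trans (evalT-substT ρ v₀ tw (substMany (d₀ ∷ us) (t₀ ∷ ts) (var v₀)))
      (trans (evalT-substMany ρ' (d₀ ∷ us) (t₀ ∷ ts) (var v₀))
      (trans (updateMany-notIn ρ' (d₀ ∷ us) (t₀ ∷ ts) v₀ ((λ e → d₀≢v₀ (sym e)) , v₀∉us)) (update-≡ ρ v₀ _)))

  evalTs-map-app : ∀ ρ {n m} (hs : Vec (FunSym n) m) (ts : Vec Term n) →
    evalTs ρ (Vec.map (λ h → app h ts) hs) ≡ Vec.map (λ h → funI h (evalTs ρ ts)) hs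
  evalTs-map-app ρ [] ts = refl
  evalTs-map-app ρ (h ∷ hs) ts = cong (_ ∷_) (evalTs-map-app ρ hs ts)

-- Elementary formulas and the Wait rule

Elementary : Formula → Set
Elementary F = T (elementary F)

elementary-∧ : ∀ A B → Elementary A → Elementary B → Elementary (A ∧' B)
elementary-∧ A B eA eB with elementary A
... | true = eB

elementary-∧⁻ : ∀ A B → Elementary (A ∧' B) → Elementary A × Elementary B
elementary-∧⁻ A B e with elementary A
... | true = tt , e

elementary-∨⁻ : ∀ A B → Elementary (A ∨' B) → Elementary A × Elementary B
elementary-∨⁻ A B e with elementary A
... | true = tt , e

elementary-allVs : ∀ {n} (xs : Vec Var n) F → Elementary F → Elementary (allVs xs F)
elementary-allVs [] F e = e
elementary-allVs (x ∷ xs) F e = elementary-allVs xs F e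

norm-elementary : ∀ F → Elementary F → norm F ≡ F
norm-elementary ⊤' e = refl
norm-elementary ⊥' e = refl
norm-elementary (atom n i ts) e = refl
norm-elementary (natom n i ts) e = refl
norm-elementary (eq s t) e = refl
norm-elementary (neq s t) e = refl
norm-elementary (A ∧' B) e =
  cong₂ _∧'_ (norm-elementary A (proj₁ (elementary-∧⁻ A B e))) (norm-elementary B (proj₂ (elementary-∧⁻ A B e)))
norm-elementary (A ∨' B) e =
  cong₂ _∨'_ (norm-elementary A (proj₁ (elementary-∨⁻ A B e))) (norm-elementary B (proj₂ (elementary-∨⁻ A B e)))
norm-elementary (all x F) e = cong (all x) (norm-elementary F e)
norm-elementary (ex x F) e = cong (ex x) (norm-elementary F e)

map-norm-elementary : ∀ Hs → All Elementary Hs → List.map norm Hs ≡ Hs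
map-norm-elementary [] [] = refl
map-norm-elementary (H ∷ Hs) (e ∷ es) = cong₂ _∷_ (norm-elementary H e) (map-norm-elementary Hs es)

elementary-plug⁻ : ∀ c X → Elementary (plug c X) → Elementary X
elementary-plug⁻ hole X e = e
elementary-plug⁻ (c ∧ₗ B) X e = elementary-plug⁻ c X (proj₁ (elementary-∧⁻ (plug c X) B e))
elementary-plug⁻ (c ∨ₗ B) X e = elementary-plug⁻ c X (proj₁ (elementary-∨⁻ (plug c X) B e))
elementary-plug⁻ (A ∧ᵣ c) X e = elementary-plug⁻ c X (proj₂ (elementary-∧⁻ A (plug c X) e))
elementary-plug⁻ (A ∨ᵣ c) X e = elementary-plug⁻ c X (proj₂ (elementary-∨⁻ A (plug c X) e))
elementary-plug⁻ (allC x c) X e = elementary-plug⁻ c X e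
elementary-plug⁻ (exC x c) X e = elementary-plug⁻ c X e

data ChoiceHeaded : Formula → Set where
  ⊓-headed : ∀ A B → ChoiceHeaded (A ⊓ B)
  ⊔-headed : ∀ A B → ChoiceHeaded (A ⊔ B)
  ⊓x-headed : ∀ x A → ChoiceHeaded (call x A)
  ⊔x-headed : ∀ x A → ChoiceHeaded (cex x A)

elementary-plug-choiceHeaded : ∀ c {X} → ChoiceHeaded X → ¬ Elementary (plug c X)
elementary-plug-choiceHeaded c {X} ch e with elementary-plug⁻ c X e
elementary-plug-choiceHeaded c (⊓-headed A B) e | ()
elementary-plug-choiceHeaded c (⊔-headed A B) e | ()
elementary-plug-choiceHeaded c (⊓x-headed x A) e | ()
elementary-plug-choiceHeaded c (⊔x-headed x A) e | ()

plug-choiceHeaded : ∀ c X {F} → ChoiceHeaded F → plug c X ≡ F → c ≡ hole × X ≡ F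
plug-choiceHeaded hole X ch e = refl , e
plug-choiceHeaded (c ∧ₗ B) X () refl
plug-choiceHeaded (c ∨ₗ B) X () refl
plug-choiceHeaded (A ∧ᵣ c) X () refl
plug-choiceHeaded (A ∨ᵣ c) X () refl
plug-choiceHeaded (allC x c) X () refl
plug-choiceHeaded (exC x c) X () refl

-- Formulas for which Wait needs no premise, as a hypothesis resp. as the goal.
InertHyp InertGoal : Formula → Set
InertHyp F = (∀ c H₀ H₁ → plug c (H₀ ⊔ H₁) ≢ F) × (∀ c x H → plug c (cex x H) ≢ F)
InertGoal F = (∀ c H₀ H₁ → plug c (H₀ ⊓ H₁) ≢ F) × (∀ c x H → plug c (call x H) ≢ F)

elementary-inertHyp : ∀ F → Elementary F → InertHyp F
elementary-inertHyp F e =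
  (λ c H₀ H₁ p → elementary-plug-choiceHeaded c (⊔-headed H₀ H₁) (subst Elementary (sym p) e)) ,
  (λ c x H p → elementary-plug-choiceHeaded c (⊔x-headed x H) (subst Elementary (sym p) e))

elementary-inertGoal : ∀ F → Elementary F → InertGoal F
elementary-inertGoal F e =
  (λ c H₀ H₁ p → elementary-plug-choiceHeaded c (⊓-headed H₀ H₁) (subst Elementary (sym p) e)) ,
  (λ c x H p → elementary-plug-choiceHeaded c (⊓x-headed x H) (subst Elementary (sym p) e))

call-inertHyp : ∀ y A → InertHyp (call y A)
call-inertHyp y A =
  (λ c H₀ H₁ p → ⊔≢call (proj₂ (plug-choiceHeaded c _ (⊓x-headed y A) p))) ,
  (λ c x H p → cex≢call (proj₂ (plug-choiceHeaded c _ (⊓x-headed y A) p)))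
  where
  ⊔≢call : ∀ {H₀ H₁} → H₀ ⊔ H₁ ≢ call y A
  ⊔≢call ()
  cex≢call : ∀ {x H} → cex x H ≢ call y A
  cex≢call ()

cex-inertGoal : ∀ y A → InertGoal (cex y A)
cex-inertGoal y A =
  (λ c H₀ H₁ p → ⊓≢cex (proj₂ (plug-choiceHeaded c _ (⊔x-headed y A) p))) ,
  (λ c x H p → call≢cex (proj₂ (plug-choiceHeaded c _ (⊔x-headed y A) p)))
  where
  ⊓≢cex : ∀ {H₀ H₁} → H₀ ⊓ H₁ ≢ cex y A
  ⊓≢cex ()
  call≢cex : ∀ {x H} → call x H ≢ cex y A
  call≢cex ()

•--injective : ∀ {A B C D} → (A •- B) ≡ (C •- D) → A ≡ C × B ≡ D
•--injective refl = refl , refl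

∈-middle : ∀ {A : Set} (Gs : List A) {X : A} {Ks L : List A} → Gs ++ X ∷ Ks ≡ L → X ∈ L
∈-middle [] refl = here refl
∈-middle (G ∷ Gs) refl = there (∈-middle Gs refl)

middle-split : ∀ {A : Set} (Gs Pre : List A) {X Y : A} {Ks Post : List A} → Gs ++ X ∷ Ks ≡ Pre ++ Y ∷ Post →
  (Gs ≡ Pre × X ≡ Y × Ks ≡ Post) ⊎ (X ∈ Pre ⊎ X ∈ Post)
middle-split [] [] refl = inj₁ (refl , refl , refl)
middle-split [] (P ∷ Pre) refl = inj₂ (inj₁ (here refl))
middle-split (G ∷ Gs) [] refl = inj₂ (inj₂ (∈-middle Gs refl))
middle-split (G ∷ Gs) (P ∷ Pre) e with ∷-injective e
... | G≡P , rest with middle-split Gs Pre rest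
... | inj₁ (a , b , c) = inj₁ (cong₂ _∷_ G≡P a , b , c)
... | inj₂ (inj₁ m) = inj₂ (inj₁ (there m))
... | inj₂ (inj₂ m) = inj₂ (inj₂ m)

WaitPremises-⊓ WaitPremises-⊔ WaitPremises-⊓x WaitPremises-⊔x : Sequent → Set₁
WaitPremises-⊓ Y = ∀ Gs c H₀ H₁ → Y ≡ (Gs •- plug c (H₀ ⊓ H₁)) → CL12 (Gs •- plug c H₀) × CL12 (Gs •- plug c H₁)
WaitPremises-⊔ Y = ∀ Gs c Ks F H₀ H₁ → Y ≡ (Gs ++ plug c (H₀ ⊔ H₁) ∷ Ks •- F) →
  CL12 (Gs ++ plug c H₀ ∷ Ks •- F) × CL12 (Gs ++ plug c H₁ ∷ Ks •- F)
WaitPremises-⊓x Y = ∀ Gs c x H → Y ≡ (Gs •- plug c (call x H)) →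
  ∃ λ y → ¬ T (occS y Y) × CL12 (Gs •- plug c (substF x (var y) H))
WaitPremises-⊔x Y = ∀ Gs c Ks F x H → Y ≡ (Gs ++ plug c (cex x H) ∷ Ks •- F) →
  ∃ λ y → ¬ T (occS y Y) × CL12 (Gs ++ plug c (substF x (var y) H) ∷ Ks •- F)

inertGoal-⊓ : ∀ Hs G → InertGoal G → WaitPremises-⊓ (Hs •- G)
inertGoal-⊓ Hs G inert Gs c H₀ H₁ e = ⊥-elim (proj₁ inert c H₀ H₁ (sym (proj₂ (•--injective e))))

inertGoal-⊓x : ∀ Hs G → InertGoal G → WaitPremises-⊓x (Hs •- G)
inertGoal-⊓x Hs G inert Gs c x H e = ⊥-elim (proj₂ inert c x H (sym (proj₂ (•--injective e))))

inertHyps-⊔ : ∀ Hs G → All InertHyp Hs → WaitPremises-⊔ (Hs •- G)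
inertHyps-⊔ Hs G inert Gs c Ks F H₀ H₁ e =
  ⊥-elim (proj₁ (All.lookup inert (∈-middle Gs (sym (proj₁ (•--injective e))))) c H₀ H₁ refl)

inertHyps-⊔x : ∀ Hs G → All InertHyp Hs → WaitPremises-⊔x (Hs •- G)
inertHyps-⊔x Hs G inert Gs c Ks F x H e =
  ⊥-elim (proj₂ (All.lookup inert (∈-middle Gs (sym (proj₁ (•--injective e))))) c x H refl)

wait-⊓x-goal : ∀ Hs p H z → All InertHyp Hs → WFs (Hs •- call p H) → ¬ T (occS z (Hs •- call p H)) →
  CL12 (Hs •- substF p (var z) H) → CL12 (Hs •- call p H)
wait-⊓x-goal Hs p H z inert wf fresh prem =
  wait wf stable ⊓-goal (inertHyps-⊔ Hs (call p H) inert) ⊓x-goal (inertHyps-⊔x Hs (call p H) inert)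
  where
  stable : Stable (Hs •- call p H)
  stable M ρ (_ , ¬⊤) = ¬⊤ tt
  ⊓-goal : WaitPremises-⊓ (Hs •- call p H)
  ⊓-goal Gs c H₀ H₁ e with plug-choiceHeaded c _ (⊓x-headed p H) (sym (proj₂ (•--injective e)))
  ... | _ , ()
  ⊓x-goal : WaitPremises-⊓x (Hs •- call p H)
  ⊓x-goal Gs c x H' e with •--injective e
  ... | refl , e₂ with plug-choiceHeaded c _ (⊓x-headed p H) (sym e₂)
  ... | refl , refl = z , fresh , prem

wait-⊔x-hyp : ∀ Pre v B Post G w → All InertHyp Pre → All InertHyp Post → InertGoal G →
  WFs (Pre ++ cex v B ∷ Post •- G) → ¬ T (occS w (Pre ++ cex v B ∷ Post •- G)) →
  CL12 (Pre ++ substF v (var w) B ∷ Post •- G) → CL12 (Pre ++ cex v B ∷ Post •- G)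
wait-⊔x-hyp Pre v B Post G w inertPre inertPost inertG wf fresh prem =
  wait wf stable (inertGoal-⊓ _ G inertG) ⊔-hyp (inertGoal-⊓x _ G inertG) ⊔x-hyp
  where
  stable : Stable (Pre ++ cex v B ∷ Post •- G)
  stable M ρ (¬hyps , _) =
    All.lookup (Eval.sat-conj⁻ M ρ _ (Eval.¬sat-neg⇒sat M ρ _ ¬hyps)) (∈-map⁺ norm (∈-middle Pre {cex v B} {Post} refl))
  ⊔-hyp : WaitPremises-⊔ (Pre ++ cex v B ∷ Post •- G)
  ⊔-hyp Gs c Ks F H₀ H₁ e with middle-split Gs Pre (sym (proj₁ (•--injective e)))
  ... | inj₁ (_ , b , _) with plug-choiceHeaded c _ (⊔x-headed v B) b
  ... | _ , ()
  ⊔-hyp Gs c Ks F H₀ H₁ e | inj₂ (inj₁ m) = ⊥-elim (proj₁ (All.lookup inertPre m) c H₀ H₁ refl)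
  ⊔-hyp Gs c Ks F H₀ H₁ e | inj₂ (inj₂ m) = ⊥-elim (proj₁ (All.lookup inertPost m) c H₀ H₁ refl)
  ⊔x-hyp : WaitPremises-⊔x (Pre ++ cex v B ∷ Post •- G)
  ⊔x-hyp Gs c Ks F x H e with •--injective e
  ... | e₁ , refl with middle-split Gs Pre (sym e₁)
  ... | inj₂ (inj₁ m) = ⊥-elim (proj₂ (All.lookup inertPre m) c x H refl)
  ... | inj₂ (inj₂ m) = ⊥-elim (proj₂ (All.lookup inertPost m) c x H refl)
  ... | inj₁ (refl , b , refl) with plug-choiceHeaded c _ (⊔x-headed v B) b
  ... | refl , refl = w , fresh , prem

wait-elementary : ∀ Hs F → All Elementary Hs → Elementary F → WFs (Hs •- F) →
  (∀ M ρ → All (Semantics.Sat M ρ) Hs → Semantics.Sat M ρ F) → CL12 (Hs •- F)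
wait-elementary Hs F eHs eF wf valid =
  wait wf stable (inertGoal-⊓ Hs F inertF) (inertHyps-⊔ Hs F inertHs) (inertGoal-⊓x Hs F inertF) (inertHyps-⊔x Hs F inertHs)
  where
  inertF = elementary-inertGoal F eF
  inertHs = All.map (λ {H} → elementary-inertHyp H) eHs
  stable : Stable (Hs •- F)
  stable M ρ rewrite map-norm-elementary Hs eHs | norm-elementary F eF =
    Eval.sat-⇒ M ρ (conj Hs) F (λ s → valid M ρ (Eval.sat-conj⁻ M ρ Hs s))

-- Variable discipline

Scoped : ℕ → ℕ → Formula → Set
Scoped L U F = (∀ x → T (freeF x F) → L ≤ x × x < U) × (∀ x → T (boundF x F) → x < L)

Scoped∞ : ℕ → Formula → Set
Scoped∞ L F = (∀ x → T (freeF x F) → L ≤ x) × (∀ x → T (boundF x F) → x < L)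

TermIn : ℕ → ℕ → Term → Set
TermIn L U t = ∀ x → T (occT x t) → L ≤ x × x < U

Scoped⇒Scoped∞ : ∀ {L U} F → Scoped L U F → Scoped∞ L F
Scoped⇒Scoped∞ F (free , bound) = (λ x fx → proj₁ (free x fx)) , bound

all-Scoped⇒Scoped∞ : ∀ {L U} {Fs : List Formula} → All (Scoped L U) Fs → All (Scoped∞ L) Fs
all-Scoped⇒Scoped∞ = All.map (λ {F} → Scoped⇒Scoped∞ F)

Scoped-mono : ∀ {L U U'} F → U ≤ U' → Scoped L U F → Scoped L U' F
Scoped-mono F le (free , bound) = (λ x fx → proj₁ (free x fx) , <-≤-trans (proj₂ (free x fx)) le) , bound

all-Scoped-mono : ∀ {L U U'} Fs → U ≤ U' → All (Scoped L U) Fs → All (Scoped L U') Fs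
all-Scoped-mono Fs le = All.map (λ {F} → Scoped-mono F le)

ParamsIn : ∀ {n} → ℕ → ℕ → Vec Var n → Var → Term → Term → Set
ParamsIn L U ps v s u = ∀ x → T (occT x s ∨ occT x u) → NotIn x ps → x ≢ v → L ≤ x × x < U

ParamsIn-mono : ∀ {n L U U'} (ps : Vec Var n) v s u → U ≤ U' → ParamsIn L U ps v s u → ParamsIn L U' ps v s u
ParamsIn-mono ps v s u le h x o x∉ps x≢v = proj₁ (h x o x∉ps x≢v) , <-≤-trans (proj₂ (h x o x∉ps x≢v)) le

scoped-⊓⊔Eq : ∀ {n} L U (ps : Vec Var n) v s u → AllBelow L ps → v < L → ParamsIn L U ps v s u →
  Scoped L U (⊓⊔Eq ps v s u)
scoped-⊓⊔Eq L U ps v s u ps<L v<L h =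
  (λ x fx → let (a , b , c) = free-⊓⊔Eq x ps v s u fx in h x a b c) ,
  (λ x bx → bound-⊓⊔Eq x ps v s u L ps<L v<L bx)

scoped∞-⊓⊔Eq : ∀ {n} L (ps : Vec Var n) v s u → AllBelow L ps → v < L →
  (∀ x → T (occT x s ∨ occT x u) → NotIn x ps → x ≢ v → L ≤ x) → Scoped∞ L (⊓⊔Eq ps v s u)
scoped∞-⊓⊔Eq L ps v s u ps<L v<L h =
  (λ x fx → let (a , b , c) = free-⊓⊔Eq x ps v s u fx in h x a b c) ,
  (λ x bx → bound-⊓⊔Eq x ps v s u L ps<L v<L bx)

occ-⊓⊔Eq-below : ∀ {n} B (ps : Vec Var n) v s u → AllBelow B ps → v < B → (∀ x → T (occT x s ∨ occT x u) → x < B) →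
  ∀ x → T (occF x (⊓⊔Eq ps v s u)) → x < B
occ-⊓⊔Eq-below B ps v s u ps<B v<B h x o with ∨⁻ (freeF x (⊓⊔Eq ps v s u)) o
... | inj₁ a = h x (proj₁ (free-⊓⊔Eq x ps v s u a))
... | inj₂ b = bound-⊓⊔Eq x ps v s u B ps<B v<B b

any-witness : ∀ {A : Set} (p : A → Bool) xs → T (any p xs) → ∃ λ e → e ∈ xs × T (p e)
any-witness p xs t = find (Anyₚ.any⁻ p xs t)

scoped∞⇒WFf : ∀ {L} F → Scoped∞ L F → WFf F
scoped∞⇒WFf F (free , bound) x fx bx = <-irrefl refl (≤-<-trans (free x fx) (bound x bx))

scoped∞⇒WFs : ∀ {L} Gs F → All (Scoped∞ L) (F ∷ Gs) → WFs (Gs •- F)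
scoped∞⇒WFs Gs F sc x fx bx with any-witness (freeF x) (F ∷ Gs) fx | any-witness (boundF x) (F ∷ Gs) bx
... | _ , m , r | _ , m' , r' =
  <-irrefl refl (≤-<-trans (proj₁ (All.lookup sc m) x r) (proj₂ (All.lookup sc m') x r'))

scoped⇒WFs : ∀ {L U} Gs F → All (Scoped L U) (F ∷ Gs) → WFs (Gs •- F)
scoped⇒WFs Gs F sc = scoped∞⇒WFs Gs F (all-Scoped⇒Scoped∞ sc)

scoped-fresh : ∀ {L U} z Fs → L ≤ U → U ≤ z → All (Scoped L U) Fs → ¬ T (any (occF z) Fs)
scoped-fresh z Fs L≤U U≤z sc t with any-witness (occF z) Fs t
... | e , m , r with ∨⁻ (freeF z e) r
... | inj₁ f = <-irrefl refl (≤-<-trans U≤z (proj₂ (proj₁ (All.lookup sc m) z f)))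
... | inj₂ b = <-irrefl refl (≤-<-trans (≤-trans L≤U U≤z) (proj₂ (All.lookup sc m) z b))

InstTerm : ℕ → ℕ → Term → Set
InstTerm L U t = (∃ λ c → t ≡ con c) ⊎ (∃ λ z → t ≡ var z × L ≤ z × z < U)

InstTerms : ∀ {n} → ℕ → ℕ → Vec Term n → Set
InstTerms L U [] = ⊤
InstTerms L U (t ∷ ts) = InstTerm L U t × InstTerms L U ts

instTerm-occ : ∀ {L U} t → InstTerm L U t → TermIn L U t
instTerm-occ t (inj₁ (c , refl)) x ()
instTerm-occ t (inj₂ (z , refl , a , b)) x o rewrite T-≡ᵇ {x} {z} o = a , b

instTerm⇒GoodTerm : ∀ {L U} t Gs F → InstTerm L U t → All (Scoped∞ L) (F ∷ Gs) → GoodTerm t (Gs •- F)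
instTerm⇒GoodTerm t Gs F (inj₁ c) _ = inj₁ c
instTerm⇒GoodTerm t Gs F (inj₂ (z , refl , L≤z , _)) sc = inj₂ (z , refl , z-unbound)
  where
  z-unbound : ¬ T (any (boundF z) (F ∷ Gs))
  z-unbound t' with any-witness (boundF z) (F ∷ Gs) t'
  ... | _ , m , r = <-irrefl refl (≤-<-trans L≤z (proj₂ (All.lookup sc m) z r))

instTerms-consecVars : ∀ L U U' n → L ≤ U' → n + U' ≤ U → InstTerms L U (vars (consecVars U' n))
instTerms-consecVars L U U' zero _ _ = tt
instTerms-consecVars L U U' (suc n) L≤U' le =
  inj₂ (U' , refl , L≤U' , ≤-trans (s≤s (m≤n+m U' n)) le) ,
  instTerms-consecVars L U (suc U') n (m≤n⇒m≤1+n L≤U') (subst (_≤ U) (sym (+-suc n U')) le)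

paramsIn-instantiate : ∀ {n L U} p (ps : Vec Var n) v s u t → ParamsIn L U (p ∷ ps) v s u → InstTerm L U t →
  ParamsIn L U ps v (substT p t s) (substT p t u)
paramsIn-instantiate p ps v s u t h it x o x∉ps x≢v with ∨⁻ (occT x (substT p t s)) o
... | inj₁ a with occ-substT x p t s a
... | inj₁ (b , x≢p) = h x (∨⁺ˡ (occT x s) _ b) (x≢p , x∉ps) x≢v
... | inj₂ c = instTerm-occ t it x c
paramsIn-instantiate p ps v s u t h it x o x∉ps x≢v | inj₂ a with occ-substT x p t u a
... | inj₁ (b , x≢p) = h x (∨⁺ʳ (occT x s) _ b) (x≢p , x∉ps) x≢v
... | inj₂ c = instTerm-occ t it x c

paramsIn-instantiateAll : ∀ {n L U} (ps : Vec Var n) v s u ts → ParamsIn L U ps v s u → InstTerms L U ts →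
  ParamsIn L U [] v (substMany ps ts s) (substMany ps ts u)
paramsIn-instantiateAll [] v s u [] h _ = h
paramsIn-instantiateAll (p ∷ ps) v s u (t ∷ ts) h (it , its) =
  paramsIn-instantiateAll ps v (substT p t s) (substT p t u) ts (paramsIn-instantiate p ps v s u t h it) its

-- Proofs in CL12 of formulas  ⊓ps ⊔v (s = u)

occ-substT-⊆ : ∀ (P : Var → Set) v t w → (∀ x → T (occT x t) → P x) → (∀ x → T (occT x w) → x ≢ v → P x) →
  ∀ x → T (occT x (substT v t w)) → P x
occ-substT-⊆ P v t w ht hw x o with occ-substT x v t w o
... | inj₁ (a , x≢v) = hw x a x≢v
... | inj₂ c = ht x c

occ-eq-substT-⊆ : ∀ (P : Var → Set) v t s u → (∀ x → T (occT x t) → P x) →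
  (∀ x → T (occT x s ∨ occT x u) → x ≢ v → P x) →
  ∀ x → T (occT x (substT v t s) ∨ occT x (substT v t u)) → P x
occ-eq-substT-⊆ P v t s u ht h x o with ∨⁻ (occT x (substT v t s)) o
... | inj₁ a = occ-substT-⊆ P v t s ht (λ y oy → h y (∨⁺ˡ (occT y s) _ oy)) x a
... | inj₂ b = occ-substT-⊆ P v t u ht (λ y oy → h y (∨⁺ʳ (occT y s) _ oy)) x b

chooseValue : ∀ {L U} Hs v s u t → All Elementary Hs → All (Scoped∞ L) Hs →
  (∀ x → T (occT x s ∨ occT x u) → x ≢ v → L ≤ x) → v < L → InstTerm L U t →
  (∀ M ρ → All (Semantics.Sat M ρ) Hs → Semantics.Sat M ρ (eq (substT v t s) (substT v t u))) →
  CL12 (Hs •- cex v (eq s u))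
chooseValue {L} Hs v s u t eHs scHs params v<L it valid =
  ⊔x-choose {Gs = Hs} {c = hole} {x = v} {H = eq s u} t
    (instTerm⇒GoodTerm t Hs chosen it (scChosen ∷ scHs))
    (scoped∞⇒WFs Hs (cex v (eq s u)) (scoped∞-⊓⊔Eq L [] v s u tt v<L (λ x o _ → params x o) ∷ scHs))
    (wait-elementary Hs chosen eHs tt (scoped∞⇒WFs Hs chosen (scChosen ∷ scHs)) valid)
  where
  chosen : Formula
  chosen = eq (substT v t s) (substT v t u)
  scChosen : Scoped∞ L chosen
  scChosen = occ-eq-substT-⊆ (L ≤_) v t s u (λ x o → proj₁ (instTerm-occ t it x o)) params , λ x ()

instantiateHyp : ∀ {L U} Pre Post G {n} (ps : Vec Var n) v s u (ts : Vec Term n) →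
  L ≤ U → All (Scoped L U) Pre → All (Scoped L U) Post → Scoped L U G →
  AllBelow L ps → v < L → AllDistinct ps → NotIn v ps → ParamsIn L U ps v s u → InstTerms L U ts →
  CL12 (Pre ++ ⊓⊔Eq [] v (substMany ps ts s) (substMany ps ts u) ∷ Post •- G) →
  CL12 (Pre ++ ⊓⊔Eq ps v s u ∷ Post •- G)
instantiateHyp Pre Post G [] v s u [] _ _ _ _ _ _ _ _ _ _ prem = prem
instantiateHyp {L} {U} Pre Post G (p ∷ ps) v s u (t ∷ ts) L≤U scPre scPost scG (p<L , ps<L) v<L (p∉ps , dps)
  (v≢p , v∉ps) params (it , its) prem =
  ⊓x-choose {Gs = Pre} {Ks = Post} {c = hole} {F = G} {x = p} {H = ⊓⊔Eq ps v s u} t good wf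
    (subst (λ X → CL12 (Pre ++ X ∷ Post •- G)) (sym unfold) rest)
  where
  params' : ParamsIn L U ps v (substT p t s) (substT p t u)
  params' = paramsIn-instantiate p ps v s u t params it
  unfold : substF p t (⊓⊔Eq ps v s u) ≡ ⊓⊔Eq ps v (substT p t s) (substT p t u)
  unfold = subst-⊓⊔Eq p t ps v s u p∉ps (λ e → v≢p (sym e))
  rest : CL12 (Pre ++ ⊓⊔Eq ps v (substT p t s) (substT p t u) ∷ Post •- G)
  rest = instantiateHyp Pre Post G ps v (substT p t s) (substT p t u) ts L≤U scPre scPost scG ps<L v<L dps v∉ps
           params' its prem
  good : GoodTerm t (Pre ++ substF p t (⊓⊔Eq ps v s u) ∷ Post •- G)
  good = subst (λ X → GoodTerm t (Pre ++ X ∷ Post •- G)) (sym unfold)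
    (instTerm⇒GoodTerm t (Pre ++ _ ∷ Post) G it
      (all-Scoped⇒Scoped∞ (scG ∷ ++⁺ scPre (scoped-⊓⊔Eq L U ps v _ _ ps<L v<L params' ∷ scPost))))
  wf : WFs (Pre ++ ⊓⊔Eq (p ∷ ps) v s u ∷ Post •- G)
  wf = scoped⇒WFs (Pre ++ ⊓⊔Eq (p ∷ ps) v s u ∷ Post) G
         (scG ∷ ++⁺ scPre (scoped-⊓⊔Eq L U (p ∷ ps) v s u (p<L , ps<L) v<L params ∷ scPost))

introGoal : ∀ {L} U Hs {n} (ps : Vec Var n) v s u →
  L ≤ U → All InertHyp Hs → All (Scoped L U) Hs →
  AllBelow L ps → v < L → AllDistinct ps → NotIn v ps → ParamsIn L U ps v s u →
  CL12 (Hs •- ⊓⊔Eq [] v (substMany ps (vars (consecVars U n)) s) (substMany ps (vars (consecVars U n)) u)) →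
  CL12 (Hs •- ⊓⊔Eq ps v s u)
introGoal U Hs [] v s u _ _ _ _ _ _ _ _ prem = prem
introGoal {L} U Hs (p ∷ ps) v s u L≤U inert scHs (p<L , ps<L) v<L (p∉ps , dps) (v≢p , v∉ps) params prem =
  wait-⊓x-goal Hs p (⊓⊔Eq ps v s u) U inert wf fresh
    (subst (λ X → CL12 (Hs •- X)) (sym (subst-⊓⊔Eq p (var U) ps v s u p∉ps (λ e → v≢p (sym e)))) rest)
  where
  sc : Scoped L U (⊓⊔Eq (p ∷ ps) v s u)
  sc = scoped-⊓⊔Eq L U (p ∷ ps) v s u (p<L , ps<L) v<L params
  wf : WFs (Hs •- ⊓⊔Eq (p ∷ ps) v s u)
  wf = scoped⇒WFs Hs (⊓⊔Eq (p ∷ ps) v s u) (sc ∷ scHs)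
  fresh : ¬ T (occS U (Hs •- ⊓⊔Eq (p ∷ ps) v s u))
  fresh = scoped-fresh U (⊓⊔Eq (p ∷ ps) v s u ∷ Hs) L≤U ≤-refl (sc ∷ scHs)
  params' : ParamsIn L (suc U) ps v (substT p (var U) s) (substT p (var U) u)
  params' = paramsIn-instantiate p ps v s u (var U) (ParamsIn-mono (p ∷ ps) v s u (n≤1+n U) params)
              (inj₂ (U , refl , L≤U , ≤-refl))
  rest : CL12 (Hs •- ⊓⊔Eq ps v (substT p (var U) s) (substT p (var U) u))
  rest = introGoal (suc U) Hs ps v (substT p (var U) s) (substT p (var U) u) (m≤n⇒m≤1+n L≤U) inert
           (all-Scoped-mono Hs (n≤1+n U) scHs) ps<L v<L dps v∉ps params' prem

-- A hypothesis  ⊓ps ⊔v (s = u)  to be instantiated at ts.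
data HypUse : Set where
  use : ∀ {n} (ps : Vec Var (suc n)) (v : Var) (s u : Term) (ts : Vec Term (suc n)) → HypUse

hypOf : HypUse → Formula
hypOf (use ps v s u ts) = ⊓⊔Eq ps v s u

-- The equation a use leaves behind, its value named U.
usedEq : ℕ → HypUse → Formula
usedEq U (use ps v s u ts) = eq (substT v (var U) (substMany ps ts s)) (substT v (var U) (substMany ps ts u))

usedEqs : ℕ → List HypUse → List Formula
usedEqs U [] = []
usedEqs U (o ∷ os) = usedEq U o ∷ usedEqs (suc U) os

ValidUses : ℕ → ℕ → ℕ → List HypUse → Set
ValidUses L U₀ U [] = ⊤
ValidUses L U₀ U (use ps v s u ts ∷ os) =
  AllBelow L ps × v < L × AllDistinct ps × NotIn v ps × ParamsIn L U₀ ps v s u × InstTerms L U ts ×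
  ValidUses L U₀ (suc U) os

validUses-scoped : ∀ {L U₀ U U'} os → ValidUses L U₀ U os → U₀ ≤ U' → All (Scoped L U') (List.map hypOf os)
validUses-scoped [] _ le = []
validUses-scoped {L} {U' = U'} (use ps v s u ts ∷ os) (ps<L , v<L , _ , _ , params , _ , ok) le =
  scoped-⊓⊔Eq L U' ps v s u ps<L v<L (ParamsIn-mono ps v s u le params) ∷ validUses-scoped os ok le

hypOf-inert : ∀ os → All InertHyp (List.map hypOf os)
hypOf-inert [] = []
hypOf-inert (use (p ∷ ps) v s u ts ∷ os) = call-inertHyp p _ ∷ hypOf-inert os

usedEqs-elementary : ∀ U os → All Elementary (usedEqs U os)
usedEqs-elementary U [] = []
usedEqs-elementary U (use ps v s u ts ∷ os) = tt ∷ usedEqs-elementary (suc U) os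

usedEq-params : ∀ {L U₀ U n} (ps : Vec Var n) v s u ts → U₀ ≤ U → ParamsIn L U₀ ps v s u → InstTerms L U ts →
  ∀ x → T (occT x (substMany ps ts s) ∨ occT x (substMany ps ts u)) → x ≢ v → L ≤ x × x < U
usedEq-params ps v s u ts le params its x o x≢v =
  paramsIn-instantiateAll ps v s u ts (ParamsIn-mono ps v s u le params) its x o tt x≢v

usedEqs-scoped∞ : ∀ {L U₀} U os → L ≤ U → U₀ ≤ U → ValidUses L U₀ U os → All (Scoped∞ L) (usedEqs U os)
usedEqs-scoped∞ U [] _ _ _ = []
usedEqs-scoped∞ {L} U (use ps v s u ts ∷ os) L≤U le (_ , _ , _ , _ , params , its , ok) =
  (occ-eq-substT-⊆ (L ≤_) v (var U) (substMany ps ts s) (substMany ps ts u) (λ x o → subst (L ≤_) (sym (T-≡ᵇ {x} {U} o)) L≤U)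
     (λ x o x≢v → proj₁ (usedEq-params ps v s u ts le params its x o x≢v)) , λ x ())
  ∷ usedEqs-scoped∞ (suc U) os (m≤n⇒m≤1+n L≤U) (m≤n⇒m≤1+n le) ok

useHyps : ∀ {L} U₀ U Pre os G → L ≤ U₀ → U₀ ≤ U → All Elementary Pre → All (Scoped L U) Pre → ValidUses L U₀ U os →
  InertGoal G → Scoped L U G →
  CL12 (Pre ++ usedEqs U os •- G) → CL12 (Pre ++ List.map hypOf os •- G)
useHyps U₀ U Pre [] G _ _ _ _ _ _ _ prem = prem
useHyps {L} U₀ U Pre (use ps v s u ts ∷ os) G L≤U₀ U₀≤U ePre scPre (ps<L , v<L , dps , v∉ps , params , its , ok)
  inertG scG prem =
  instantiateHyp Pre (List.map hypOf os) G ps v s u ts L≤U scPre scOs scG ps<L v<L dps v∉ps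
    (ParamsIn-mono ps v s u U₀≤U params) its
    (wait-⊔x-hyp Pre v (eq s' u') (List.map hypOf os) G U
       (All.map (λ {F} → elementary-inertHyp F) ePre) (hypOf-inert os) inertG wf fresh
       (subst (λ X → CL12 (X •- G)) (++-assoc Pre (e ∷ []) (List.map hypOf os)) rest))
  where
  L≤U : L ≤ U
  L≤U = ≤-trans L≤U₀ U₀≤U
  s' u' : Term
  s' = substMany ps ts s
  u' = substMany ps ts u
  e : Formula
  e = usedEq U (use ps v s u ts)
  scOs : All (Scoped L U) (List.map hypOf os)
  scOs = validUses-scoped os ok U₀≤U
  all-sc : All (Scoped L U) (G ∷ Pre ++ ⊓⊔Eq [] v s' u' ∷ List.map hypOf os)
  all-sc = scG ∷ ++⁺ scPre (scoped-⊓⊔Eq L U [] v s' u' tt v<L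
                               (λ x o _ x≢v → usedEq-params ps v s u ts U₀≤U params its x o x≢v) ∷ scOs)
  wf : WFs (Pre ++ ⊓⊔Eq [] v s' u' ∷ List.map hypOf os •- G)
  wf = scoped⇒WFs (Pre ++ ⊓⊔Eq [] v s' u' ∷ List.map hypOf os) G all-sc
  fresh : ¬ T (occS U (Pre ++ ⊓⊔Eq [] v s' u' ∷ List.map hypOf os •- G))
  fresh = scoped-fresh U (G ∷ Pre ++ ⊓⊔Eq [] v s' u' ∷ List.map hypOf os) L≤U ≤-refl all-sc
  sc-e : Scoped L (suc U) e
  sc-e = occ-eq-substT-⊆ (λ x → L ≤ x × x < suc U) v (var U) s' u'
           (λ x o → subst (λ y → L ≤ y × y < suc U) (sym (T-≡ᵇ {x} {U} o)) (L≤U , ≤-refl))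
           (λ x o x≢v → let (a , b) = usedEq-params ps v s u ts U₀≤U params its x o x≢v in a , m≤n⇒m≤1+n b) ,
         λ x ()
  rest : CL12 ((Pre ++ e ∷ []) ++ List.map hypOf os •- G)
  rest = useHyps U₀ (suc U) (Pre ++ e ∷ []) os G L≤U₀ (m≤n⇒m≤1+n U₀≤U) (++⁺ ePre (tt ∷ []))
           (++⁺ (all-Scoped-mono Pre (n≤1+n U) scPre) (sc-e ∷ [])) ok inertG (Scoped-mono G (n≤1+n U) scG)
           (subst (λ X → CL12 (X •- G)) (sym (++-assoc Pre (e ∷ []) (usedEqs (suc U) os))) prem)

-- Totality formulas in canonical variables

-- v₀ = N, d₀ = N+1 and cvars n = N+2, …, N+n+1 lie above every variable of the hypotheses and of the goal
-- (all below N) and below Lb; the variables the CL12 proofs introduce are all ≥ Lb.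
module Canonical (N A : ℕ) where
  v₀ d₀ Lb : ℕ
  v₀ = N
  d₀ = suc N
  Lb = A + suc (suc N)

  cvars : (n : ℕ) → Vec Var n
  cvars n = consecVars (suc (suc N)) n

  -- The dummy ⊓d₀ keeps Total s ⊓-headed also for nullary symbols, so that Wait never acts on it as a hypothesis.
  Total : Sym → Formula
  Total (n , g) = ⊓⊔Eq (d₀ ∷ cvars n) v₀ (app g (vars (cvars n))) (var v₀)

  SuccTotal : Formula
  SuccTotal = ⊓⊔Eq (d₀ ∷ []) v₀ (var v₀) (S (var d₀))

  d₀≢v₀ : d₀ ≢ v₀
  d₀≢v₀ e = <-irrefl (sym e) ≤-refl

  v₀<Lb : v₀ < Lb
  v₀<Lb = ≤-trans (n≤1+n (suc N)) (m≤n+m (suc (suc N)) A)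

  d₀<Lb : d₀ < Lb
  d₀<Lb = m≤n+m (suc (suc N)) A

  cvars-below : ∀ n → n ≤ A → AllBelow Lb (cvars n)
  cvars-below n n≤A = consecVars-below (suc (suc N)) n Lb (+-monoˡ-≤ (suc (suc N)) n≤A)

  cvars-distinct : ∀ n → AllDistinct (cvars n)
  cvars-distinct n = consecVars-distinct (suc (suc N)) n

  d₀∉cvars : ∀ n → NotIn d₀ (cvars n)
  d₀∉cvars n = consecVars-notIn d₀ (suc (suc N)) n ≤-refl

  v₀∉cvars : ∀ n → NotIn v₀ (cvars n)
  v₀∉cvars n = consecVars-notIn v₀ (suc (suc N)) n (n≤1+n (suc N))

  above-Lb-fresh : ∀ {n} → n ≤ A → ∀ x → Lb ≤ x → NotIn x (d₀ ∷ cvars n) × x ≢ v₀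
  above-Lb-fresh {n} n≤A x Lb≤x =
    ((λ e → <-irrefl (sym e) (<-≤-trans d₀<Lb Lb≤x)) , allBelow-notIn Lb (cvars n) x (cvars-below n n≤A) Lb≤x) ,
    (λ e → <-irrefl (sym e) (<-≤-trans v₀<Lb Lb≤x))

  consecVars-clear : ∀ {n} → n ≤ A → ∀ U → Lb ≤ U → ∀ k →
    AllAvoid (vars (consecVars U k)) (cvars n) × (∀ x → T (occTs x (vars (consecVars U k))) → Lb ≤ x)
  consecVars-clear {n} n≤A U Lb≤U k =
    allAvoid-consecVars U k (cvars n) (λ z U≤z → proj₂ (proj₁ (above-Lb-fresh n≤A z (≤-trans Lb≤U U≤z)))) ,
    λ x o → ≤-trans Lb≤U (proj₁ (occ-consecVars x U k o))

  params-app : ∀ {L U k n} (g : FunSym (k + n)) (rs : Vec Term k) → (∀ x → T (occTs x rs) → L ≤ x × x < U) →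
    ParamsIn L U (d₀ ∷ cvars n) v₀ (app g (rs Vec.++ vars (cvars n))) (var v₀)
  params-app {n = n} g rs rs-in x o x∉ x≢v₀ with ∨⁻ (occT x (app g (rs Vec.++ vars (cvars n)))) o
  ... | inj₂ b = ⊥-elim (x≢v₀ (T-≡ᵇ b))
  ... | inj₁ a with occTs-++ x rs (vars (cvars n)) a
  ... | inj₁ c = rs-in x c
  ... | inj₂ c = ⊥-elim (occ-vars-notIn x (cvars n) c (proj₂ x∉))

  -- The goal variables d₀, cvars n are introduced as U₀, U₀+1, …, U₀+n.
  goalValues : ∀ (M : Structure) (ρ : Var → Structure.Dom M) U₀ n → Vec (Structure.Dom M) n
  goalValues M ρ U₀ n = Semantics.evalTs M ρ (vars (consecVars (suc U₀) n))

  Forces : ∀ (U₀ : ℕ) (Hs : List Formula) {k n} (f : FunSym (k + n)) (rs : Vec Term k) (t : Term) → Set₁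
  Forces U₀ Hs {n = n} f rs t = ∀ M ρ → All (Semantics.Sat M ρ) Hs →
    ¬ ¬ (Structure.funI M f (Semantics.evalTs M ρ rs Vec.++ goalValues M ρ U₀ n) ≡ Semantics.evalT M ρ t)

  -- The hypotheses' values are named U₁, U₁+1, ….
  totalityByUses : ∀ {L Ut} U₀ U₁ Pre os {k n} (f : FunSym (k + n)) (rs : Vec Term k) t →
    n ≤ A → Lb ≤ L → L ≤ U₀ → suc n + U₀ ≤ U₁ →
    All Elementary Pre → All (Scoped L U₀) Pre → ValidUses L U₀ U₁ os →
    (∀ x → T (occTs x rs) → L ≤ x × x < U₀) → InstTerm L Ut t → Forces U₀ (Pre ++ usedEqs U₁ os) f rs t →
    CL12 (Pre ++ List.map hypOf os •- ⊓⊔Eq (d₀ ∷ cvars n) v₀ (app f (rs Vec.++ vars (cvars n))) (var v₀))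
  totalityByUses {L} U₀ U₁ Pre os {n = n} f rs t n≤A Lb≤L L≤U₀ le ePre scPre ok rs-in it valid =
    introGoal U₀ (Pre ++ List.map hypOf os) ps v₀ s (var v₀) L≤U₀
      (++⁺ (All.map (λ {F} → elementary-inertHyp F) ePre) (hypOf-inert os)) (++⁺ scPre (validUses-scoped os ok ≤-refl))
      (<-≤-trans d₀<Lb Lb≤L , AllBelow-mono (cvars n) Lb≤L (cvars-below n n≤A)) (<-≤-trans v₀<Lb Lb≤L)
      (d₀∉cvars n , cvars-distinct n) ((λ e → d₀≢v₀ (sym e)) , v₀∉cvars n) params
      (useHyps U₀ U₁ Pre os (⊓⊔Eq [] v₀ s' u') L≤U₀ U₀≤U₁ ePre (all-Scoped-mono Pre U₀≤U₁ scPre) ok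
         (cex-inertGoal v₀ (eq s' u')) (scoped-⊓⊔Eq L U₁ [] v₀ s' u' tt (<-≤-trans v₀<Lb Lb≤L) params')
         (chooseValue (Pre ++ usedEqs U₁ os) v₀ s' u' t (++⁺ ePre (usedEqs-elementary U₁ os))
            (++⁺ (all-Scoped⇒Scoped∞ scPre) (usedEqs-scoped∞ U₁ os (≤-trans L≤U₀ U₀≤U₁) U₀≤U₁ ok))
            (λ x o x≢v₀ → proj₁ (params' x o tt x≢v₀)) (<-≤-trans v₀<Lb Lb≤L) it valid'))
    where
    ps : Vec Var (suc n)
    ps = d₀ ∷ cvars n
    goalVals : Vec Term (suc n)
    goalVals = vars (consecVars U₀ (suc n))
    s s' u' : Term
    s = app f (rs Vec.++ vars (cvars n))
    s' = substMany ps goalVals s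
    u' = substMany ps goalVals (var v₀)
    U₀≤U₁ : U₀ ≤ U₁
    U₀≤U₁ = ≤-trans (m≤n+m U₀ (suc n)) le
    params : ParamsIn L U₀ ps v₀ s (var v₀)
    params = params-app f rs rs-in
    params' : ParamsIn L U₁ [] v₀ s' u'
    params' = ParamsIn-mono [] v₀ s' u' le
      (paramsIn-instantiateAll ps v₀ s (var v₀) goalVals (ParamsIn-mono ps v₀ s (var v₀) (m≤n+m U₀ (suc n)) params)
         (instTerms-consecVars L (suc n + U₀) U₀ (suc n) L≤U₀ ≤-refl))
    clear : AllAvoid (vars (consecVars (suc U₀) n)) (cvars n) × (∀ x → T (occTs x (vars (consecVars (suc U₀) n))) → Lb ≤ x)
    clear = consecVars-clear n≤A (suc U₀) (≤-trans Lb≤L (m≤n⇒m≤1+n L≤U₀)) n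
    valid' : ∀ M ρ → All (Semantics.Sat M ρ) (Pre ++ usedEqs U₁ os) →
      Semantics.Sat M ρ (eq (substT v₀ t s') (substT v₀ t u'))
    valid' M ρ h ¬e = valid M ρ h (λ e → ¬e (trans
      (Eval.evalT-inst-app M ρ d₀ v₀ t (cvars n) (var U₀) _ (cvars-distinct n) (d₀∉cvars n) (v₀∉cvars n) d₀≢v₀
         (proj₁ clear) (λ x o → proj₂ (above-Lb-fresh n≤A x (proj₂ clear x o))) f rs
         (λ x o → above-Lb-fresh n≤A x (≤-trans Lb≤L (proj₁ (rs-in x o)))))
      (trans e (sym (Eval.evalT-inst-var M ρ d₀ v₀ t (cvars n) (var U₀) _ (cvars-distinct n) (d₀∉cvars n) (v₀∉cvars n)
         d₀≢v₀ (proj₁ clear) (λ x o → proj₂ (above-Lb-fresh n≤A x (proj₂ clear x o))))))))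

  useTotal : ∀ {k n} (g : FunSym (k + n)) (rs : Vec Term k) (ts : Vec Term (suc n)) → HypUse
  useTotal {n = n} g rs ts = use (d₀ ∷ cvars n) v₀ (app g (rs Vec.++ vars (cvars n))) (var v₀) ts

  validUses-useTotal : ∀ {L U₀ k n} (g : FunSym (k + n)) (rs : Vec Term k) (ts : Vec Term (suc n)) U os →
    n ≤ A → Lb ≤ L → (∀ x → T (occTs x rs) → L ≤ x × x < U₀) → InstTerms L U ts → ValidUses L U₀ (suc U) os →
    ValidUses L U₀ U (useTotal g rs ts ∷ os)
  validUses-useTotal {n = n} g rs ts U os n≤A Lb≤L rs-in its ok =
    (<-≤-trans d₀<Lb Lb≤L , AllBelow-mono (cvars n) Lb≤L (cvars-below n n≤A)) , <-≤-trans v₀<Lb Lb≤L ,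
    (d₀∉cvars n , cvars-distinct n) , ((λ e → d₀≢v₀ (sym e)) , v₀∉cvars n) , params-app g rs rs-in , its , ok

  usedEq-useTotal : ∀ {k n} (g : FunSym (k + n)) (rs : Vec Term k) t₀ (ts : Vec Term n) U → n ≤ A →
    (∀ x → T (occTs x rs) → Lb ≤ x) → (∀ x → T (occTs x ts) → Lb ≤ x) → AllAvoid ts (cvars n) →
    ∀ M ρ → Semantics.Sat M ρ (usedEq U (useTotal g rs (t₀ ∷ ts))) →
    ¬ ¬ (Structure.funI M g (Semantics.evalTs M ρ rs Vec.++ Semantics.evalTs M ρ ts) ≡ ρ U)
  usedEq-useTotal {n = n} g rs t₀ ts U n≤A rs-above ts-above ts-avoid M ρ =
    ¬¬-map (λ e → trans (sym (Eval.evalT-inst-app M ρ d₀ v₀ (var U) (cvars n) t₀ ts (cvars-distinct n) (d₀∉cvars n)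
                                 (v₀∉cvars n) d₀≢v₀ ts-avoid ts≢v₀ g rs (λ x o → above-Lb-fresh n≤A x (rs-above x o))))
                  (trans e (Eval.evalT-inst-var M ρ d₀ v₀ (var U) (cvars n) t₀ ts (cvars-distinct n) (d₀∉cvars n)
                                 (v₀∉cvars n) d₀≢v₀ ts-avoid ts≢v₀)))
    where
    ts≢v₀ : ∀ x → T (occTs x ts) → x ≢ v₀
    ts≢v₀ x o = proj₂ (above-Lb-fresh n≤A x (ts-above x o))

  module Derivations (U₀ : ℕ) (Lb≤U₀ : Lb ≤ U₀) where

    total-zero : ∀ {n} (f : FunSym n) (xs : Vec Var n) → AllDistinct xs → n ≤ A →
      let E = allVs xs (eq (app f (vars xs)) (con 0)) in Scoped Lb U₀ E → CL12 (E ∷ [] •- Total (n , f))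
    total-zero {n} f xs dxs n≤A scE =
      totalityByUses {Ut = U₀} U₀ (suc n + U₀) (E ∷ []) [] {k = 0} f [] (con 0) n≤A ≤-refl Lb≤U₀ ≤-refl
        (elementary-allVs xs _ tt ∷ []) (scE ∷ []) tt (λ x ()) (inj₁ (0 , refl)) valid
      where
      E = allVs xs (eq (app f (vars xs)) (con 0))
      valid : Forces U₀ (E ∷ []) {k = 0} f [] (con 0)
      valid M ρ (sE ∷ []) =
        ¬¬-map (trans (cong (funI f) (sym (evalTs-vars-updateAll ρ xs Z dxs)))) (sat-allVs⁻ ρ xs _ Z sE)
        where
        open Structure M
        open Eval M
        Z = goalValues M ρ U₀ n

    total-proj : ∀ {n} (f : FunSym n) (xs : Vec Var n) → AllDistinct xs → (i : Fin n) → n ≤ A →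
      let E = allVs xs (eq (app f (vars xs)) (var (lookup xs i))) in Scoped Lb U₀ E → CL12 (E ∷ [] •- Total (n , f))
    total-proj {n} f xs dxs i n≤A scE =
      totalityByUses U₀ (suc n + U₀) (E ∷ []) [] {k = 0} f [] (var zᵢ) n≤A ≤-refl Lb≤U₀ ≤-refl
        (elementary-allVs xs _ tt ∷ []) (scE ∷ []) tt (λ x ()) zᵢ-inst valid
      where
      E = allVs xs (eq (app f (vars xs)) (var (lookup xs i)))
      zs = consecVars (suc U₀) n
      zᵢ = lookup zs i
      zᵢ-inst : InstTerm Lb (suc n + U₀) (var zᵢ)
      zᵢ-inst = inj₂ (zᵢ , refl , ≤-trans Lb≤U₀ (<⇒≤ (proj₁ (lookup-consecVars (suc U₀) i))) ,
                      subst (zᵢ <_) (+-suc n U₀) (proj₂ (lookup-consecVars (suc U₀) i)))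
      valid : Forces U₀ (E ∷ []) {k = 0} f [] (var zᵢ)
      valid M ρ (sE ∷ []) = ¬¬-map (λ e → trans (cong (funI f) (sym R-xs)) (trans e R-xᵢ)) (sat-allVs⁻ ρ xs _ Z sE)
        where
        open Structure M
        open Eval M
        open ≡-Reasoning
        Z = goalValues M ρ U₀ n
        R = updateAll ρ xs Z
        R-xs : Semantics.evalTs M R (vars xs) ≡ Z
        R-xs = evalTs-vars-updateAll ρ xs Z dxs
        R-xᵢ : R (lookup xs i) ≡ ρ zᵢ
        R-xᵢ = begin
          R (lookup xs i)                           ≡⟨ Vecₚ.lookup-map i R xs ⟨
          lookup (Vec.map R xs) i                   ≡⟨ cong (λ v → lookup v i) (trans (sym (evalTs-vars R xs)) R-xs) ⟩
          lookup Z i                                ≡⟨ cong (λ v → lookup v i) (evalTs-vars ρ zs) ⟩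
          lookup (Vec.map ρ zs) i                   ≡⟨ Vecₚ.lookup-map i ρ zs ⟩
          ρ zᵢ                                      ∎

    total-succ : ∀ (f : FunSym 1) x → 1 ≤ A →
      let E = all x (eq (app f (var x ∷ [])) (S (var x))) in Scoped Lb U₀ E → CL12 (E ∷ SuccTotal ∷ [] •- Total (1 , f))
    total-succ f x 1≤A scE =
      totalityByUses U₀ U₁ (E ∷ []) (useSucc ∷ []) {k = 0} f [] (var U₁) 1≤A ≤-refl Lb≤U₀ ≤-refl
        (tt ∷ []) (scE ∷ []) ok (λ x ()) (inj₂ (U₁ , refl , m≤n⇒m≤1+n (m≤n⇒m≤1+n Lb≤U₀) , ≤-refl)) valid
      where
      E = all x (eq (app f (var x ∷ [])) (S (var x)))
      z = suc U₀
      U₁ = suc z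
      useSucc = use (d₀ ∷ []) v₀ (var v₀) (S (var d₀)) (var z ∷ [])
      v₀<z : v₀ < z
      v₀<z = <-≤-trans v₀<Lb (m≤n⇒m≤1+n Lb≤U₀)
      params : ParamsIn Lb U₀ (d₀ ∷ []) v₀ (var v₀) (S (var d₀))
      params y o (y≢d₀ , _) y≢v₀ with ∨⁻ (y ≡ᵇ v₀) o
      ... | inj₁ a = ⊥-elim (y≢v₀ (T-≡ᵇ a))
      ... | inj₂ b with ∨⁻ (y ≡ᵇ d₀) b
      ... | inj₁ c = ⊥-elim (y≢d₀ (T-≡ᵇ c))
      ok : ValidUses Lb U₀ U₁ (useSucc ∷ [])
      ok = (d₀<Lb , tt) , v₀<Lb , (tt , tt) , ((λ e → d₀≢v₀ (sym e)) , tt) , params ,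
           (inj₂ (z , refl , m≤n⇒m≤1+n Lb≤U₀ , ≤-refl) , tt) , tt
      usedEq-succ : usedEq U₁ useSucc ≡ eq (var U₁) (S (var z))
      usedEq-succ = cong₂ eq
        (trans (cong (substT v₀ (var U₁)) (substT-var-≢ d₀ (var z) v₀ d₀≢v₀)) (substT-var-≡ v₀ (var U₁)))
        (cong (λ t → app succ (t ∷ []))
          (trans (cong (substT v₀ (var U₁)) (substT-var-≡ d₀ (var z))) (substT-var-≢ v₀ (var U₁) z (<⇒≢ v₀<z))))
      valid : Forces U₀ (E ∷ usedEqs U₁ (useSucc ∷ [])) {k = 0} f [] (var U₁)
      valid M ρ (sE ∷ sU ∷ []) ¬fz≡U₁ =
        sat-allVs⁻ ρ (x ∷ []) (eq (app f (var x ∷ [])) (S (var x))) (ρ z ∷ []) sE λ fz≡z' →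
        subst (Semantics.Sat M ρ) usedEq-succ sU λ U₁≡z' →
        ¬fz≡U₁ (trans (subst (λ d → funI f (d ∷ []) ≡ funI succ (d ∷ [])) (update-≡ ρ x (ρ z)) fz≡z') (sym U₁≡z'))
        where
        open Structure M
        open Eval M

    -- h₁(Z), …, h_m(Z) are named U, U+1, …; then g applied to these names gets the next name.
    compositionUses : ∀ {n m m'} (g : FunSym m) (hs : Vec (FunSym n) m') → List HypUse
    compositionUses {n} {m} g [] = useTotal g [] (con 0 ∷ vars (consecVars (suc n + U₀) m)) ∷ []
    compositionUses {n} g (h ∷ hs) = useTotal h [] (con 0 ∷ vars (consecVars (suc U₀) n)) ∷ compositionUses g hs

    validUses-composition : ∀ {n m m'} (g : FunSym m) (hs : Vec (FunSym n) m') U → n ≤ A → m ≤ A →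
      suc n + U₀ ≤ U → m + (suc n + U₀) ≤ m' + U → ValidUses Lb U₀ U (compositionUses g hs)
    validUses-composition {n} {m} g [] U n≤A m≤A _ le =
      validUses-useTotal g [] _ U [] m≤A ≤-refl (λ x ())
        (inj₁ (0 , refl) , instTerms-consecVars Lb U (suc n + U₀) m (≤-trans Lb≤U₀ (m≤n+m U₀ (suc n))) le) tt
    validUses-composition {n} {m} {suc m'} g (h ∷ hs) U n≤A m≤A le₁ le₂ =
      validUses-useTotal h [] _ U (compositionUses g hs) n≤A ≤-refl (λ x ())
        (inj₁ (0 , refl) , instTerms-consecVars Lb U (suc U₀) n (m≤n⇒m≤1+n Lb≤U₀) (subst (_≤ U) (sym (+-suc n U₀)) le₁))
        (validUses-composition g hs (suc U) n≤A m≤A (m≤n⇒m≤1+n le₁) (subst (m + (suc n + U₀) ≤_) (sym (+-suc m' U)) le₂))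

    usedEqs-composition : ∀ M ρ {n m m'} (g : FunSym m) (hs : Vec (FunSym n) m') U → n ≤ A → m ≤ A →
      All (Semantics.Sat M ρ) (usedEqs U (compositionUses g hs)) →
      let open Structure M in
      ¬ ¬ (Vec.map (λ h → funI h (goalValues M ρ U₀ n)) hs ≡ Vec.map ρ (consecVars U m') ×
           funI g (Vec.map ρ (consecVars (suc n + U₀) m)) ≡ ρ (m' + U))
    usedEqs-composition M ρ {n} {m} g [] U n≤A m≤A (s ∷ []) =
      ¬¬-map (λ e → refl , trans (cong (funI g) (sym (evalTs-vars ρ (consecVars (suc n + U₀) m)))) e)
        (usedEq-useTotal g [] (con 0) _ U m≤A (λ x ()) (proj₂ clear) (proj₁ clear) M ρ s)
      where
      open Structure M
      open Eval M
      clear = consecVars-clear m≤A (suc n + U₀) (≤-trans Lb≤U₀ (m≤n+m U₀ (suc n))) m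
    usedEqs-composition M ρ {n} {m} {suc m'} g (h ∷ hs) U n≤A m≤A (s ∷ ss) ¬both =
      usedEq-useTotal h [] (con 0) _ U n≤A (λ x ()) (proj₂ clear) (proj₁ clear) M ρ s λ hZ≡U →
      usedEqs-composition M ρ g hs (suc U) n≤A m≤A ss λ (hsZ≡ , gV≡) →
      ¬both (cong₂ _∷_ hZ≡U hsZ≡ , trans gV≡ (cong ρ (+-suc m' U)))
      where
      clear = consecVars-clear n≤A (suc U₀) (m≤n⇒m≤1+n Lb≤U₀) n

    total-comp : ∀ {n m} (f : FunSym n) (g : FunSym m) (hs : Vec (FunSym n) m) (xs : Vec Var n) → AllDistinct xs →
      n ≤ A → m ≤ A → let E = allVs xs (eq (app f (vars xs)) (app g (Vec.map (λ h → app h (vars xs)) hs))) in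
      Scoped Lb U₀ E → CL12 (E ∷ List.map hypOf (compositionUses g hs) •- Total (n , f))
    total-comp {n} {m} f g hs xs dxs n≤A m≤A scE =
      totalityByUses U₀ U₁ (E ∷ []) (compositionUses g hs) {k = 0} f [] (var (m + U₁)) n≤A ≤-refl Lb≤U₀ ≤-refl
        (elementary-allVs xs _ tt ∷ []) (scE ∷ []) (validUses-composition g hs U₁ n≤A m≤A ≤-refl ≤-refl) (λ x ())
        (inj₂ (_ , refl , ≤-trans Lb≤U₀ (≤-trans (m≤n+m U₀ (suc n)) (m≤n+m U₁ m)) , ≤-refl)) valid
      where
      E = allVs xs (eq (app f (vars xs)) (app g (Vec.map (λ h → app h (vars xs)) hs)))
      U₁ = suc n + U₀
      valid : Forces U₀ (E ∷ usedEqs U₁ (compositionUses g hs)) {k = 0} f [] (var (m + U₁))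
      valid M ρ (sE ∷ ss) ¬goal =
        sat-allVs⁻ ρ xs _ Z sE λ fR≡gR →
        usedEqs-composition M ρ g hs U₁ n≤A m≤A ss λ (hsZ≡ , gV≡) →
        ¬goal (begin
          funI f Z                                     ≡⟨ cong (funI f) R-xs ⟨
          funI f (evalTs R (vars xs))                  ≡⟨ fR≡gR ⟩
          funI g (evalTs R (Vec.map (λ h → app h (vars xs)) hs))
                                                       ≡⟨ cong (funI g) (evalTs-map-app R hs (vars xs)) ⟩
          funI g (Vec.map (λ h → funI h (evalTs R (vars xs))) hs)
                                                       ≡⟨ cong (λ v → funI g (Vec.map (λ h → funI h v) hs)) R-xs ⟩
          funI g (Vec.map (λ h → funI h Z) hs)         ≡⟨ cong (funI g) hsZ≡ ⟩
          funI g (Vec.map ρ (consecVars U₁ m))         ≡⟨ gV≡ ⟩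
          ρ (m + U₁)                                   ∎)
        where
        open Structure M
        open Semantics M
        open Eval M
        open ≡-Reasoning
        Z = goalValues M ρ U₀ n
        R = updateAll ρ xs Z
        R-xs : evalTs R (vars xs) ≡ Z
        R-xs = evalTs-vars-updateAll ρ xs Z dxs

    module Recursion {n} (f : FunSym (suc n)) (g : FunSym n) (h : FunSym (suc (suc n))) (x₁ : Var) (xs : Vec Var n)
                     (dxs : AllDistinct (x₁ ∷ xs)) (n+2≤A : suc (suc n) ≤ A) where
      E₀ E₁ E : Formula
      E₀ = allVs xs (eq (app f (con 0 ∷ vars xs)) (app g (vars xs)))
      E₁ = all x₁ (allVs xs (eq (app f (S (var x₁) ∷ vars xs)) (app h (var x₁ ∷ app f (var x₁ ∷ vars xs) ∷ vars xs))))
      E = E₀ ∧' E₁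

      -- The formula H(r) of the CI step.
      RecTotal : Term → Formula
      RecTotal r = ⊓⊔Eq (d₀ ∷ cvars n) v₀ (app f (r ∷ vars (cvars n))) (var v₀)

      n+1≤A : suc n ≤ A
      n+1≤A = ≤-trans (n≤1+n (suc n)) n+2≤A

      n≤A : n ≤ A
      n≤A = ≤-trans (n≤1+n n) n+1≤A

      private
        us : Vec Var n
        us = cvars n
        zs : Vec Var n
        zs = consecVars (suc U₀) n
        U₁ : ℕ
        U₁ = suc n + U₀
        Lb≤U₁ : Lb ≤ U₁
        Lb≤U₁ = ≤-trans Lb≤U₀ (m≤n+m U₀ (suc n))
        E-elementary : Elementary E
        E-elementary = elementary-∧ E₀ E₁ (elementary-allVs xs _ tt) (elementary-allVs xs _ tt)
        zs-clear : AllAvoid (vars zs) us × (∀ x → T (occTs x (vars zs)) → Lb ≤ x)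
        zs-clear = consecVars-clear n≤A (suc U₀) (m≤n⇒m≤1+n Lb≤U₀) n
        zs-inst : ∀ U → U₁ ≤ U → InstTerms Lb U (vars zs)
        zs-inst U le = instTerms-consecVars Lb U (suc U₀) n (m≤n⇒m≤1+n Lb≤U₀) (≤-trans (≤-reflexive (+-suc n U₀)) le)
        var-in : ∀ c → Lb ≤ c → c < U₀ → ∀ x → T (occTs x (var c ∷ [])) → Lb ≤ x × x < U₀
        var-in c Lb≤c c<U₀ x o with ∨⁻ (occT x (var c)) o
        ... | inj₁ b rewrite T-≡ᵇ {x} {c} b = Lb≤c , c<U₀
        succ-in : ∀ c → Lb ≤ c → c < U₀ → ∀ x → T (occTs x (S (var c) ∷ [])) → Lb ≤ x × x < U₀
        succ-in c Lb≤c c<U₀ x o with ∨⁻ (occT x (S (var c))) o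
        ... | inj₁ a = var-in c Lb≤c c<U₀ x a

      total-rec-zero : Scoped Lb U₀ E → CL12 (E ∷ Total (n , g) ∷ [] •- RecTotal (con 0))
      total-rec-zero scE =
        totalityByUses U₀ U₁ (E ∷ []) (useG ∷ []) {k = 1} f (con 0 ∷ []) (var U₁) n≤A ≤-refl Lb≤U₀ ≤-refl
          (E-elementary ∷ []) (scE ∷ [])
          (validUses-useTotal g [] _ U₁ [] n≤A ≤-refl (λ x ()) (inj₁ (0 , refl) , zs-inst U₁ ≤-refl) tt)
          (λ x ()) (inj₂ (U₁ , refl , Lb≤U₁ , ≤-refl)) valid
        where
        useG = useTotal g [] (con 0 ∷ vars zs)
        valid : Forces U₀ (E ∷ usedEqs U₁ (useG ∷ [])) {k = 1} f (con 0 ∷ []) (var U₁)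
        valid M ρ ((sE₀ , _) ∷ sG ∷ []) ¬goal =
          sat-allVs⁻ ρ xs _ Z sE₀ λ f0≡g →
          usedEq-useTotal g [] (con 0) (vars zs) U₁ n≤A (λ x ()) (proj₂ zs-clear) (proj₁ zs-clear) M ρ sG λ gZ≡U₁ →
          ¬goal (trans (cong (λ v → funI f (conI 0 ∷ v)) (sym R-xs)) (trans f0≡g (trans (cong (funI g) R-xs) gZ≡U₁)))
          where
          open Structure M
          open Eval M
          Z = goalValues M ρ U₀ n
          R-xs = evalTs-vars-updateAll ρ xs Z (proj₂ dxs)

      module Step (c : Var) (Lb≤c : Lb ≤ c) (c<U₀ : c < U₀) where
        private
          U₂ : ℕ
          U₂ = suc U₁
          hArgs : Vec Term (suc (suc n))
          hArgs = var c ∷ var U₁ ∷ vars zs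
          useF useH : HypUse
          useF = useTotal {1} {n} f (var c ∷ []) (con 0 ∷ vars zs)
          useH = useTotal {0} {suc (suc n)} h [] (con 0 ∷ hArgs)

        validUses-step : ValidUses Lb U₀ U₁ (useF ∷ useH ∷ [])
        validUses-step =
          validUses-useTotal f (var c ∷ []) _ U₁ (useH ∷ []) n≤A ≤-refl (var-in c Lb≤c c<U₀)
            (inj₁ (0 , refl) , zs-inst U₁ ≤-refl)
            (validUses-useTotal h [] _ U₂ [] n+2≤A ≤-refl (λ x ())
               (inj₁ (0 , refl) , inj₂ (c , refl , Lb≤c , m≤n⇒m≤1+n (<-≤-trans c<U₀ (m≤n+m U₀ (suc n)))) ,
                inj₂ (U₁ , refl , Lb≤U₁ , ≤-refl) , zs-inst U₂ (n≤1+n U₁)) tt)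

        hArgs-above : ∀ x → T (occTs x hArgs) → Lb ≤ x
        hArgs-above x o with ∨⁻ (occT x (var c)) o
        ... | inj₁ a rewrite T-≡ᵇ {x} {c} a = Lb≤c
        ... | inj₂ b with ∨⁻ (occT x (var U₁)) b
        ... | inj₁ a rewrite T-≡ᵇ {x} {U₁} a = Lb≤U₁
        ... | inj₂ d = proj₂ zs-clear x d

        hArgs-avoid : AllAvoid hArgs (cvars (suc (suc n)))
        hArgs-avoid =
          inj₂ (c , refl , allBelow-notIn Lb _ c (cvars-below _ n+2≤A) Lb≤c) ,
          inj₂ (U₁ , refl , allBelow-notIn Lb _ U₁ (cvars-below _ n+2≤A) Lb≤U₁) ,
          proj₁ (consecVars-clear n+2≤A (suc U₀) (m≤n⇒m≤1+n Lb≤U₀) n)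

        -- f(c', Z) = h(c, f(c, Z), Z) = h(c, U₁, Z) = U₂
        step-valid : Forces U₀ (E ∷ usedEqs U₁ (useF ∷ useH ∷ [])) {k = 1} f (S (var c) ∷ []) (var U₂)
        step-valid M ρ ((_ , sE₁) ∷ sF ∷ sH ∷ []) ¬goal =
          sat-allVs⁻ ρ (x₁ ∷ xs) _ (ρ c ∷ Z) sE₁ λ step →
          usedEq-useTotal f (var c ∷ []) (con 0) (vars zs) U₁ n≤A (λ x o → proj₁ (var-in c Lb≤c c<U₀ x o))
            (proj₂ zs-clear) (proj₁ zs-clear) M ρ sF λ fcZ≡U₁ →
          usedEq-useTotal h [] (con 0) hArgs U₂ n+2≤A (λ x ()) hArgs-above hArgs-avoid M ρ sH λ hcU₁Z≡U₂ →
          ¬goal (trans (step-at-c step) (trans (cong (λ d → funI h (ρ c ∷ d ∷ Z)) fcZ≡U₁) hcU₁Z≡U₂))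
          where
          open Structure M
          open Semantics M
          open Eval M
          Z = goalValues M ρ U₀ n
          R = updateAll ρ (x₁ ∷ xs) (ρ c ∷ Z)
          R-x₁xs = evalTs-vars-updateAll ρ (x₁ ∷ xs) (ρ c ∷ Z) dxs
          step-at-c : funI f (funI succ (R x₁ ∷ []) ∷ evalTs R (vars xs))
                        ≡ funI h (R x₁ ∷ funI f (R x₁ ∷ evalTs R (vars xs)) ∷ evalTs R (vars xs)) →
                      funI f (funI succ (ρ c ∷ []) ∷ Z) ≡ funI h (ρ c ∷ funI f (ρ c ∷ Z) ∷ Z)
          step-at-c = subst₂ (λ a vs → funI f (funI succ (a ∷ []) ∷ vs) ≡ funI h (a ∷ funI f (a ∷ vs) ∷ vs))
                        (Vecₚ.∷-injectiveˡ R-x₁xs) (Vecₚ.∷-injectiveʳ R-x₁xs)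

        total-rec-suc : Scoped Lb U₀ E → CL12 (E ∷ RecTotal (var c) ∷ Total (suc (suc n) , h) ∷ [] •- RecTotal (S (var c)))
        total-rec-suc scE =
          totalityByUses U₀ U₁ (E ∷ []) (useF ∷ useH ∷ []) {k = 1} f (S (var c) ∷ []) (var U₂) n≤A ≤-refl Lb≤U₀ ≤-refl
            (E-elementary ∷ []) (scE ∷ []) validUses-step (succ-in c Lb≤c c<U₀)
            (inj₂ (U₂ , refl , m≤n⇒m≤1+n Lb≤U₁ , ≤-refl)) step-valid

      private
        U₁' : ℕ
        U₁' = suc (suc n) + U₀
        rest : Vec Term n
        rest = vars (consecVars (suc (suc U₀)) n)

      -- ⊓c H(c) is used at c := U₀+1, d₀ := 0 and us := U₀+2, …, the values of the goal's variables.
      useCI : Var → HypUse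
      useCI c = use (c ∷ d₀ ∷ us) v₀ (app f (var c ∷ vars us)) (var v₀) (var (suc U₀) ∷ con 0 ∷ rest)

      usedEq-useCI : ∀ c → Lb ≤ c → ∀ M ρ → Semantics.Sat M ρ (usedEq U₁' (useCI c)) →
        ¬ ¬ (Structure.funI M f (goalValues M ρ U₀ (suc n)) ≡ ρ U₁')
      usedEq-useCI c Lb≤c M ρ = ¬¬-map (λ e → trans (sym lhs) (trans e rhs))
        where
        open Structure M
        open Semantics M
        open Eval M
        z = suc U₀
        inst = var z ∷ con 0 ∷ rest
        s = app f (var c ∷ vars us)
        c-fresh = above-Lb-fresh n≤A c Lb≤c
        z-fresh = above-Lb-fresh n≤A z (≤-trans Lb≤U₀ (n≤1+n U₀))
        rest-clear = consecVars-clear n≤A (suc z) (≤-trans Lb≤U₀ (≤-trans (n≤1+n U₀) (n≤1+n z))) n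
        ρ' = update ρ v₀ (ρ U₁')
        R₀ = updateMany ρ' us rest
        R₁ = update R₀ d₀ (conI 0)
        R = update R₁ c (R₁ z)
        R-c : R c ≡ ρ z
        R-c = trans (update-≡ R₁ c _) (trans (updateMany-notIn ρ' (d₀ ∷ us) (con 0 ∷ rest) z (proj₁ z-fresh))
                (update-≢ ρ v₀ _ z (λ e → proj₂ z-fresh (sym e))))
        R-us : evalTs R (vars us) ≡ evalTs ρ rest
        R-us = trans (evalTs-vars-update R₁ c _ us (proj₂ (proj₁ c-fresh)))
               (trans (evalTs-vars-update R₀ d₀ _ us (d₀∉cvars n))
               (trans (evalTs-vars-updateMany ρ' us rest (cvars-distinct n) (proj₁ rest-clear))
                      (evalTs-cong ρ' ρ rest (λ x o → update-≢ ρ v₀ _ x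
                        (λ e → proj₂ (above-Lb-fresh n≤A x (proj₂ rest-clear x o)) (sym e))))))
        lhs : evalT ρ (substT v₀ (var U₁') (substMany (c ∷ d₀ ∷ us) inst s)) ≡ funI f (ρ z ∷ evalTs ρ rest)
        lhs = trans (evalT-substT ρ v₀ (var U₁') (substMany (c ∷ d₀ ∷ us) inst s))
              (trans (evalT-substMany ρ' (c ∷ d₀ ∷ us) inst s) (cong₂ (λ a b → funI f (a ∷ b)) R-c R-us))
        rhs : evalT ρ (substT v₀ (var U₁') (substMany (c ∷ d₀ ∷ us) inst (var v₀))) ≡ ρ U₁'
        rhs = trans (evalT-substT ρ v₀ (var U₁') (substMany (c ∷ d₀ ∷ us) inst (var v₀)))
              (trans (evalT-substMany ρ' (c ∷ d₀ ∷ us) inst (var v₀))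
              (trans (updateMany-notIn ρ' (c ∷ d₀ ∷ us) inst v₀ ((λ e → proj₂ c-fresh (sym e)) , (λ e → d₀≢v₀ (sym e)) , v₀∉cvars n))
                     (update-≡ ρ v₀ _)))

      -- ⊓c H(c) binds c, so the fresh variables start at U₀ instead of Lb.
      validUses-useCI : ∀ c → Lb ≤ c → c < U₀ → ValidUses U₀ U₀ U₁' (useCI c ∷ [])
      validUses-useCI c Lb≤c c<U₀ =
        (c<U₀ , <-≤-trans d₀<Lb Lb≤U₀ , AllBelow-mono us Lb≤U₀ (cvars-below n n≤A)) , <-≤-trans v₀<Lb Lb≤U₀ ,
        (proj₁ c-fresh , d₀∉cvars n , cvars-distinct n) ,
        ((λ e → proj₂ c-fresh (sym e)) , (λ e → d₀≢v₀ (sym e)) , v₀∉cvars n) , params ,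
        (inj₂ (suc U₀ , refl , n≤1+n U₀ , s≤s (s≤s (m≤n+m U₀ n))) , inj₁ (0 , refl) ,
         instTerms-consecVars U₀ U₁' (suc (suc U₀)) n (≤-trans (n≤1+n U₀) (n≤1+n (suc U₀)))
           (≤-reflexive (trans (+-suc n (suc U₀)) (cong suc (+-suc n U₀))))) , tt
        where
        c-fresh = above-Lb-fresh n≤A c Lb≤c
        params : ParamsIn U₀ U₀ (c ∷ d₀ ∷ us) v₀ (app f (var c ∷ vars us)) (var v₀)
        params x o x∉ x≢v₀ with ∨⁻ (occT x (app f (var c ∷ vars us))) o
        ... | inj₂ b = ⊥-elim (x≢v₀ (T-≡ᵇ b))
        ... | inj₁ a with ∨⁻ (occT x (var c)) a
        ... | inj₁ b = ⊥-elim (proj₁ x∉ (T-≡ᵇ b))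
        ... | inj₂ b = ⊥-elim (occ-vars-notIn x us b (proj₂ (proj₂ x∉)))

      total-rec-close : ∀ c → Lb ≤ c → c < U₀ → CL12 (call c (RecTotal (var c)) ∷ [] •- Total (suc n , f))
      total-rec-close c Lb≤c c<U₀ =
        totalityByUses U₀ U₁' [] (useCI c ∷ []) {k = 0} f [] (var U₁') n+1≤A Lb≤U₀ ≤-refl ≤-refl [] []
          (validUses-useCI c Lb≤c c<U₀) (λ x ())
          (inj₂ (U₁' , refl , ≤-trans (n≤1+n U₀) (≤-trans (n≤1+n (suc U₀)) (s≤s (s≤s (m≤n+m U₀ n)))) , ≤-refl))
          (λ M ρ → λ { (sU ∷ []) → usedEq-useCI c Lb≤c M ρ sU })

    module Goal {n} (f : FunSym n) (xs : Vec Var n) (y : Var) (n≤A : n ≤ A) (dxs : AllDistinct xs) (y∉xs : NotIn y xs)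
                (xs<Lb : AllBelow Lb xs) (y<Lb : y < Lb) where
      private
        zs : Vec Var n
        zs = consecVars U₀ n
        U₁ : ℕ
        U₁ = n + U₀
        s s' u' : Term
        s = app f (vars xs)
        s' = substMany xs (vars zs) s
        u' = substMany xs (vars zs) (var y)
        useF : HypUse
        useF = useTotal f [] (con 0 ∷ vars zs)
        zs-inst : InstTerms Lb U₁ (vars zs)
        zs-inst = instTerms-consecVars Lb U₁ U₀ n Lb≤U₀ ≤-refl

      ok : ValidUses Lb U₀ U₁ (useF ∷ [])
      ok = validUses-useTotal f [] _ U₁ [] n≤A ≤-refl (λ x ()) (inj₁ (0 , refl) , zs-inst) tt

      params : ParamsIn Lb U₀ xs y s (var y)
      params x o x∉xs x≢y with ∨⁻ (occT x s) o
      ... | inj₁ a = ⊥-elim (occ-vars-notIn x xs a x∉xs)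
      ... | inj₂ b = ⊥-elim (x≢y (T-≡ᵇ b))

      params' : ParamsIn Lb U₁ [] y s' u'
      params' = paramsIn-instantiateAll xs y s (var y) (vars zs) (ParamsIn-mono xs y s (var y) (m≤n+m U₀ n) params) zs-inst

      valid : ∀ M ρ → All (Semantics.Sat M ρ) (usedEqs U₁ (useF ∷ [])) →
        Semantics.Sat M ρ (eq (substT y (var U₁) s') (substT y (var U₁) u'))
      valid M ρ (sF ∷ []) ¬goal =
        usedEq-useTotal f [] (con 0) (vars zs) U₁ n≤A (λ x ()) (proj₂ zs-clear) (proj₁ zs-clear) M ρ sF λ fZ≡U₁ →
        ¬goal (trans lhs (trans fZ≡U₁ (sym rhs)))
        where
        open Structure M
        open Semantics M
        open Eval M
        zs-clear = consecVars-clear n≤A U₀ Lb≤U₀ n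
        above-fresh : ∀ x → Lb ≤ x → NotIn x xs × x ≢ y
        above-fresh x Lb≤x = allBelow-notIn Lb xs x xs<Lb Lb≤x , (λ e → <-irrefl (sym e) (<-≤-trans y<Lb Lb≤x))
        ρ' = update ρ y (ρ U₁)
        lhs : evalT ρ (substT y (var U₁) s') ≡ funI f (evalTs ρ (vars zs))
        lhs = trans (evalT-substT ρ y (var U₁) s') (trans (evalT-substMany ρ' xs (vars zs) s)
               (cong (funI f) (trans (evalTs-vars-updateMany ρ' xs (vars zs) dxs
                                        (allAvoid-consecVars U₀ n xs (λ z U₀≤z → proj₁ (above-fresh z (≤-trans Lb≤U₀ U₀≤z)))))
                 (evalTs-cong ρ' ρ (vars zs) (λ x o → update-≢ ρ y _ x
                   (λ e → proj₂ (above-fresh x (proj₂ zs-clear x o)) (sym e)))))))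
        rhs : evalT ρ (substT y (var U₁) u') ≡ ρ U₁
        rhs = trans (evalT-substT ρ y (var U₁) u') (trans (evalT-substMany ρ' xs (vars zs) (var y))
               (trans (updateMany-notIn ρ' xs (vars zs) y y∉xs) (update-≡ ρ y _)))

      goal-from-total : CL12 (Total (n , f) ∷ [] •- ⊓⊔Eq xs y (app f (vars xs)) (var y))
      goal-from-total =
        introGoal U₀ (List.map hypOf (useF ∷ [])) xs y s (var y) Lb≤U₀ (hypOf-inert (useF ∷ []))
          (validUses-scoped (useF ∷ []) ok ≤-refl) xs<Lb y<Lb dxs y∉xs params
          (useHyps U₀ U₁ [] (useF ∷ []) (⊓⊔Eq [] y s' u') Lb≤U₀ (m≤n+m U₀ n) [] [] ok (cex-inertGoal y (eq s' u'))
             (scoped-⊓⊔Eq Lb U₁ [] y s' u' tt y<Lb params')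
             (chooseValue (usedEqs U₁ (useF ∷ [])) y s' u' (var U₁) (usedEqs-elementary U₁ (useF ∷ []))
                (usedEqs-scoped∞ U₁ (useF ∷ []) (≤-trans Lb≤U₀ (m≤n+m U₀ n)) (m≤n+m U₀ n) ok)
                (λ x o x≢y → proj₁ (params' x o tt x≢y)) y<Lb (inj₂ (U₁ , refl , ≤-trans Lb≤U₀ (m≤n+m U₀ n) , ≤-refl))
                valid))

-- Closedness and variable bounds of the hypotheses

binderBound : Formula → ℕ
binderBound (A ∧' B) = binderBound A + binderBound B
binderBound (A ∨' B) = binderBound A + binderBound B
binderBound (A ⊓ B) = binderBound A + binderBound B
binderBound (A ⊔ B) = binderBound A + binderBound B
binderBound (all x A) = suc x + binderBound A
binderBound (ex x A) = suc x + binderBound A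
binderBound (call x A) = suc x + binderBound A
binderBound (cex x A) = suc x + binderBound A
binderBound _ = 0

private
  <-+-either : ∀ x {a b} (ma mb : ℕ) → (T a → x < ma) → (T b → x < mb) → T (a ∨ b) → x < ma + mb
  <-+-either x {a} ma mb ha hb o with ∨⁻ a o
  ... | inj₁ p = <-≤-trans (ha p) (m≤m+n ma mb)
  ... | inj₂ q = <-≤-trans (hb q) (m≤n+m mb ma)

  binder< : ∀ x y → T (x ≡ᵇ y) → x < suc y
  binder< x y t = s≤s (≤-reflexive (T-≡ᵇ t))

bound<binderBound : ∀ x F → T (boundF x F) → x < binderBound F
bound<binderBound x (A ∧' B) = <-+-either x (binderBound A) (binderBound B) (bound<binderBound x A) (bound<binderBound x B)
bound<binderBound x (A ∨' B) = <-+-either x (binderBound A) (binderBound B) (bound<binderBound x A) (bound<binderBound x B)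
bound<binderBound x (A ⊓ B) = <-+-either x (binderBound A) (binderBound B) (bound<binderBound x A) (bound<binderBound x B)
bound<binderBound x (A ⊔ B) = <-+-either x (binderBound A) (binderBound B) (bound<binderBound x A) (bound<binderBound x B)
bound<binderBound x (all y A) = <-+-either x (suc y) (binderBound A) (binder< x y) (bound<binderBound x A)
bound<binderBound x (ex y A) = <-+-either x (suc y) (binderBound A) (binder< x y) (bound<binderBound x A)
bound<binderBound x (call y A) = <-+-either x (suc y) (binderBound A) (binder< x y) (bound<binderBound x A)
bound<binderBound x (cex y A) = <-+-either x (suc y) (binderBound A) (binder< x y) (bound<binderBound x A)

binderBounds : List Formula → ℕ
binderBounds [] = 0
binderBounds (E ∷ Es) = binderBound E + binderBounds Es

binderBound≤binderBounds : ∀ {E} Es → E ∈ Es → binderBound E ≤ binderBounds Es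
binderBound≤binderBounds (E ∷ Es) (here refl) = m≤m+n (binderBound E) (binderBounds Es)
binderBound≤binderBounds (E ∷ Es) (there m) = ≤-trans (binderBound≤binderBounds Es m) (m≤n+m (binderBounds Es) (binderBound E))

varsBound : ∀ {n} → Vec Var n → ℕ
varsBound [] = 0
varsBound (x ∷ xs) = suc x + varsBound xs

lookup<varsBound : ∀ {n} (xs : Vec Var n) i → lookup xs i < varsBound xs
lookup<varsBound (x ∷ xs) Fin.zero = <-≤-trans ≤-refl (m≤m+n (suc x) (varsBound xs))
lookup<varsBound (x ∷ xs) (Fin.suc i) = <-≤-trans (lookup<varsBound xs i) (m≤n+m (varsBound xs) (suc x))

aritySum : ∀ {m} → Vec Sym m → ℕ
aritySum [] = 0
aritySum ((n , _) ∷ gs) = n + aritySum gs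

arity≤aritySum : ∀ {m} (gs : Vec Sym m) i → proj₁ (lookup gs i) ≤ aritySum gs
arity≤aritySum ((n , _) ∷ gs) Fin.zero = m≤m+n n (aritySum gs)
arity≤aritySum ((n , _) ∷ gs) (Fin.suc i) = ≤-trans (arity≤aritySum gs i) (m≤n+m (aritySum gs) n)

free-allVs⁻ : ∀ x {n} (xs : Vec Var n) A → T (freeF x (allVs xs A)) → T (freeF x A) × NotIn x xs
free-allVs⁻ x [] A o = o , tt
free-allVs⁻ x (y ∷ ys) A o with x ≡ᵇ y in e
... | false with free-allVs⁻ x ys A o
... | a , b = a , ((λ x≡y → subst T e (≡⇒≡ᵇ x y x≡y)) , b)

VarsAmong : ∀ {n} → Term → Vec Var n → Set
VarsAmong t xs = ∀ y → T (occT y t) → ¬ NotIn y xs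

AllVarsAmong : ∀ {m n} → Vec Term m → Vec Var n → Set
AllVarsAmong ts xs = ∀ y → T (occTs y ts) → ¬ NotIn y xs

varsAmong-con : ∀ {n} c (xs : Vec Var n) → VarsAmong (con c) xs
varsAmong-con c xs y ()

varsAmong-var : ∀ {n} (xs : Vec Var n) i → VarsAmong (var (lookup xs i)) xs
varsAmong-var (x ∷ xs) Fin.zero y o (y≢x , _) = y≢x (T-≡ᵇ o)
varsAmong-var (x ∷ xs) (Fin.suc i) y o (_ , y∉xs) = varsAmong-var xs i y o y∉xs

varsAmong-head : ∀ {n} x (xs : Vec Var n) → VarsAmong (var x) (x ∷ xs)
varsAmong-head x xs = varsAmong-var (x ∷ xs) Fin.zero

allVarsAmong-[] : ∀ {n} (xs : Vec Var n) → AllVarsAmong [] xs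
allVarsAmong-[] xs y ()

allVarsAmong-∷ : ∀ {m n} t (ts : Vec Term m) (xs : Vec Var n) → VarsAmong t xs → AllVarsAmong ts xs →
  AllVarsAmong (t ∷ ts) xs
allVarsAmong-∷ t ts xs h hs y o y∉ with ∨⁻ (occT y t) o
... | inj₁ a = h y a y∉
... | inj₂ b = hs y b y∉

allVarsAmong-vars : ∀ {n} (xs : Vec Var n) → AllVarsAmong (vars xs) xs
allVarsAmong-vars xs y o y∉ = occ-vars-notIn y xs o y∉

allVarsAmong-∷ʳ : ∀ {m n} (ts : Vec Term m) x (xs : Vec Var n) → AllVarsAmong ts xs → AllVarsAmong ts (x ∷ xs)
allVarsAmong-∷ʳ ts x xs h y o (_ , y∉xs) = h y o y∉xs

allVarsAmong-map-app : ∀ {m n k} (hs : Vec (FunSym n) m) (ts : Vec Term n) (xs : Vec Var k) → AllVarsAmong ts xs →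
  AllVarsAmong (Vec.map (λ h → app h ts) hs) xs
allVarsAmong-map-app [] ts xs h = allVarsAmong-[] xs
allVarsAmong-map-app (g ∷ hs) ts xs h =
  allVarsAmong-∷ (app g ts) (Vec.map (λ h → app h ts) hs) xs h (allVarsAmong-map-app hs ts xs h)

allVs-eq-closed : ∀ {n} (xs : Vec Var n) s t → VarsAmong s xs → VarsAmong t xs → ∀ x → ¬ T (freeF x (allVs xs (eq s t)))
allVs-eq-closed xs s t hs ht x o with free-allVs⁻ x xs (eq s t) o
... | f , x∉xs with ∨⁻ (occT x s) f
... | inj₁ a = hs x a x∉xs
... | inj₂ b = ht x b x∉xs

PRDef-closed : ∀ {P s E} → PRDef P s E → ∀ x → ¬ T (freeF x E)
PRDef-closed (defI g x) = allVs-eq-closed (x ∷ []) (app g (var x ∷ [])) (S (var x)) arg arg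
  where arg = allVarsAmong-∷ (var x) [] (x ∷ []) (varsAmong-head x []) (allVarsAmong-[] _)
PRDef-closed (defII g xs _) = allVs-eq-closed xs (app g (vars xs)) (con 0) (allVarsAmong-vars xs) (varsAmong-con 0 xs)
PRDef-closed (defIII g xs _ i) =
  allVs-eq-closed xs (app g (vars xs)) (var (lookup xs i)) (allVarsAmong-vars xs) (varsAmong-var xs i)
PRDef-closed (defIV f g hs xs _ _ _) =
  allVs-eq-closed xs (app f (vars xs)) (app g (Vec.map (λ h → app h (vars xs)) hs))
    (allVarsAmong-vars xs) (allVarsAmong-map-app hs (vars xs) xs (allVarsAmong-vars xs))
PRDef-closed (defV f g h x₁ xs _ _ _) x o with ∨⁻ (freeF x (allVs xs (eq (app f (con 0 ∷ vars xs)) (app g (vars xs))))) o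
... | inj₁ a =
  allVs-eq-closed xs (app f (con 0 ∷ vars xs)) (app g (vars xs))
    (allVarsAmong-∷ (con 0) (vars xs) xs (varsAmong-con 0 xs) (allVarsAmong-vars xs)) (allVarsAmong-vars xs) x a
... | inj₂ b =
  allVs-eq-closed X (app f (S (var x₁) ∷ vars xs)) (app h (var x₁ ∷ f-x₁xs ∷ vars xs))
    (allVarsAmong-∷ (S (var x₁)) (vars xs) X (allVarsAmong-∷ (var x₁) [] X x₁∈ (allVarsAmong-[] X)) xs∈)
    (allVarsAmong-∷ (var x₁) (f-x₁xs ∷ vars xs) X x₁∈
      (allVarsAmong-∷ f-x₁xs (vars xs) X (allVarsAmong-∷ (var x₁) (vars xs) X x₁∈ xs∈) xs∈))
    x b
  where
  X = x₁ ∷ xs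
  f-x₁xs = app f (var x₁ ∷ vars xs)
  x₁∈ = varsAmong-head x₁ xs
  xs∈ = allVarsAmong-∷ʳ (vars xs) x₁ xs (allVarsAmong-vars xs)

-- Deductions

checks-++ : ∀ P is js → Checks P is → Checks (is ʳ++ P) js → Checks P (is ++ js)
checks-++ P [] js _ c = c
checks-++ P (step F ∷ is) js (w , j , c) c' = w , j , checks-++ (step F ∷ P) is js c c'
checks-++ P (sub hs ks ∷ is) js (w , j , c) c' = w , j , checks-++ (sub hs ks ∷ P) is js c c'

∈-ʳ++⁺ʳ : ∀ {A : Set} {x : A} is P → x ∈ P → x ∈ is ʳ++ P
∈-ʳ++⁺ʳ [] P m = m
∈-ʳ++⁺ʳ (i ∷ is) P m = ∈-ʳ++⁺ʳ is (i ∷ P) (there m)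

All-ʳ++⁺ : ∀ {A : Set} {Q : A → Set} is P → All Q P → All Q is → All Q (is ʳ++ P)
All-ʳ++⁺ [] P a _ = a
All-ʳ++⁺ (i ∷ is) P a (q ∷ qs) = All-ʳ++⁺ is (i ∷ P) (q ∷ a) qs

ItemBelow : ℕ → Item → Set
ItemBelow B e = ∀ x → T (occItem x e) → x < B

all-ItemBelow-mono : ∀ {a b} {Is : List Item} → a ≤ b → All (ItemBelow a) Is → All (ItemBelow b) Is
all-ItemBelow-mono le = All.map (λ h x o → <-≤-trans (h x o) le)

closed-scoped∞ : ∀ {L} F → (∀ x → ¬ T (freeF x F)) → (∀ x → T (boundF x F) → x < L) → Scoped∞ L F
closed-scoped∞ F closed bound = (λ x fx → ⊥-elim (closed x fx)) , bound

closed-below : ∀ {B} F → (∀ x → ¬ T (freeF x F)) → (∀ x → T (boundF x F) → x < B) → ItemBelow B (step F)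
closed-below F closed bound x o with ∨⁻ (freeF x F) o
... | inj₁ a = ⊥-elim (closed x a)
... | inj₂ b = bound x b

module Assembly (N A U₀ : ℕ) (Lb≤U₀ : Canonical.Lb N A ≤ U₀) where
  open Canonical N A
  open Derivations U₀ Lb≤U₀

  total-closed : ∀ s x → ¬ T (freeF x (Total s))
  total-closed (n , g) x o with free-⊓⊔Eq x (d₀ ∷ cvars n) v₀ (app g (vars (cvars n))) (var v₀) o
  ... | occ , x∉ , x≢v₀ with ∨⁻ (occT x (app g (vars (cvars n)))) occ
  ... | inj₁ a = occ-vars-notIn x (cvars n) a (proj₂ x∉)
  ... | inj₂ b = x≢v₀ (T-≡ᵇ b)

  total-bound : ∀ s → proj₁ s ≤ A → ∀ x → T (boundF x (Total s)) → x < Lb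
  total-bound (n , g) n≤A x =
    bound-⊓⊔Eq x (d₀ ∷ cvars n) v₀ (app g (vars (cvars n))) (var v₀) Lb (d₀<Lb , cvars-below n n≤A) v₀<Lb

  total-WFf : ∀ s → proj₁ s ≤ A → WFf (Total s)
  total-WFf s s≤A = scoped∞⇒WFf (Total s) (closed-scoped∞ (Total s) (total-closed s) (total-bound s s≤A))

  total-below : ∀ s → proj₁ s ≤ A → ∀ B → Lb ≤ B → ItemBelow B (step (Total s))
  total-below s s≤A B Lb≤B = closed-below (Total s) (total-closed s) (λ x b → <-≤-trans (total-bound s s≤A x b) Lb≤B)

  succTotal-closed : ∀ x → ¬ T (freeF x SuccTotal)
  succTotal-closed x o with free-⊓⊔Eq x (d₀ ∷ []) v₀ (var v₀) (S (var d₀)) o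
  ... | occ , (x≢d₀ , _) , x≢v₀ with ∨⁻ (occT x (var v₀)) occ
  ... | inj₁ a = x≢v₀ (T-≡ᵇ a)
  ... | inj₂ b with ∨⁻ (occT x (var d₀)) b
  ... | inj₁ a = x≢d₀ (T-≡ᵇ a)

  succTotal-bound : ∀ x → T (boundF x SuccTotal) → x < Lb
  succTotal-bound x = bound-⊓⊔Eq x (d₀ ∷ []) v₀ (var v₀) (S (var d₀)) Lb (d₀<Lb , tt) v₀<Lb

  TotalBlock : List Item → Sym → ℕ → Set₁
  TotalBlock P s c = Σ (List Item) λ blk → Checks P blk × step (Total s) ∈ blk ʳ++ P × All (ItemBelow (suc c)) blk

  lcBlock : ∀ P s c Gs → Lb ≤ c → proj₁ s ≤ A → All (λ G → step G ∈ P) Gs → CL12 (Gs •- Total s) → TotalBlock P s c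
  lcBlock P s c Gs Lb≤c s≤A Gs∈P proof =
    step (Total s) ∷ [] , (total-WFf s s≤A , by-LC Gs Gs∈P proof , _) , here refl ,
    (total-below s s≤A (suc c) (m≤n⇒m≤1+n Lb≤c) ∷ [])

  succBlock : ∀ P (g : FunSym 1) x c → Lb ≤ c → 1 ≤ A → let E = all x (eq (app g (var x ∷ [])) (S (var x))) in
    step E ∈ P → Scoped Lb U₀ E → TotalBlock P (1 , g) c
  succBlock P g x c Lb≤c 1≤A E∈P scE =
    step SuccTotal ∷ step (Total (1 , g)) ∷ [] ,
    (scoped∞⇒WFf SuccTotal (closed-scoped∞ SuccTotal succTotal-closed succTotal-bound) ,
     by-axiom (ax-succ d₀ v₀ d₀≢v₀) ,
     (total-WFf (1 , g) 1≤A , by-LC (_ ∷ SuccTotal ∷ []) (there E∈P ∷ here refl ∷ []) (total-succ g x 1≤A scE) , _)) ,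
    here refl ,
    (closed-below SuccTotal succTotal-closed (λ x b → <-≤-trans (succTotal-bound x b) (m≤n⇒m≤1+n Lb≤c)) ∷
     total-below (1 , g) 1≤A (suc c) (m≤n⇒m≤1+n Lb≤c) ∷ [])

  compositionUses-∈ : ∀ P {n m m'} (g : FunSym m) (hs : Vec (FunSym n) m') → (∀ j → step (Total (n , lookup hs j)) ∈ P) →
    step (Total (m , g)) ∈ P → All (λ G → step G ∈ P) (List.map hypOf (compositionUses g hs))
  compositionUses-∈ P g [] hs∈ g∈ = g∈ ∷ []
  compositionUses-∈ P g (h ∷ hs) hs∈ g∈ = hs∈ Fin.zero ∷ compositionUses-∈ P g hs (λ j → hs∈ (Fin.suc j)) g∈

  module RecBlock {n} (f : FunSym (suc n)) (g : FunSym n) (h : FunSym (suc (suc n))) (x₁ : Var) (xs : Vec Var n)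
                  (d : Distinct (x₁ ∷ xs)) (n+2≤A : suc (suc n) ≤ A) where
    open Recursion f g h x₁ xs (Distinct⇒AllDistinct (x₁ ∷ xs) d) n+2≤A

    private
      us : Vec Var n
      us = cvars n
      s[_] : Term → Term
      s[ r ] = app f (r ∷ vars us)

    RecTotal-subst : ∀ c t → Lb ≤ c → substF c t (RecTotal (var c)) ≡ RecTotal t
    RecTotal-subst c t Lb≤c =
      trans (subst-⊓⊔Eq c t (d₀ ∷ us) v₀ s[ var c ] (var v₀) (proj₁ c-fresh) (proj₂ c-fresh))
            (cong₂ (⊓⊔Eq (d₀ ∷ us) v₀)
               (cong (λ r → app f r) (cong₂ _∷_ (substT-var-≡ c t) (substTs-vars-notIn c t us (proj₂ (proj₁ c-fresh)))))
               (substT-var-≢ c t v₀ (proj₂ c-fresh)))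
      where c-fresh = above-Lb-fresh n≤A c Lb≤c

    occ-RecTotal : ∀ r x → T (occT x s[ r ] ∨ occT x (var v₀)) → T (occT x r) ⊎ (T (occTs x (vars us)) ⊎ x ≡ v₀)
    occ-RecTotal r x o with ∨⁻ (occT x s[ r ]) o
    ... | inj₂ b = inj₂ (inj₂ (T-≡ᵇ b))
    ... | inj₁ a with ∨⁻ (occT x r) a
    ... | inj₁ p = inj₁ p
    ... | inj₂ q = inj₂ (inj₁ q)

    RecTotal-WFf : ∀ r → (∀ x → T (occT x r) → Lb ≤ x) → WFf (RecTotal r)
    RecTotal-WFf r r-above = scoped∞⇒WFf (RecTotal r)
      (scoped∞-⊓⊔Eq Lb (d₀ ∷ us) v₀ s[ r ] (var v₀) (d₀<Lb , cvars-below n n≤A) v₀<Lb params)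
      where
      params : ∀ x → T (occT x s[ r ] ∨ occT x (var v₀)) → NotIn x (d₀ ∷ us) → x ≢ v₀ → Lb ≤ x
      params x o x∉ x≢v₀ with occ-RecTotal r x o
      ... | inj₁ p = r-above x p
      ... | inj₂ (inj₁ q) = ⊥-elim (occ-vars-notIn x us q (proj₂ x∉))
      ... | inj₂ (inj₂ e) = ⊥-elim (x≢v₀ e)

    RecTotal-below : ∀ r B → Lb ≤ B → (∀ x → T (occT x r) → x < B) → ∀ x → T (occF x (RecTotal r)) → x < B
    RecTotal-below r B Lb≤B r-below =
      occ-⊓⊔Eq-below B (d₀ ∷ us) v₀ s[ r ] (var v₀) (<-≤-trans d₀<Lb Lb≤B , AllBelow-mono us Lb≤B (cvars-below n n≤A))
        (<-≤-trans v₀<Lb Lb≤B) below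
      where
      below : ∀ x → T (occT x s[ r ] ∨ occT x (var v₀)) → x < B
      below x o with occ-RecTotal r x o
      ... | inj₁ p = r-below x p
      ... | inj₂ (inj₁ q) = <-≤-trans (occ-vars-below Lb us x (cvars-below n n≤A) q) Lb≤B
      ... | inj₂ (inj₂ refl) = <-≤-trans v₀<Lb Lb≤B

    CI-WFf : ∀ c → Lb ≤ c → WFf (call c (RecTotal (var c)))
    CI-WFf c Lb≤c = scoped∞⇒WFf (call c (RecTotal (var c)))
      (scoped∞-⊓⊔Eq (suc c) (c ∷ d₀ ∷ us) v₀ s[ var c ] (var v₀) binders (<-≤-trans v₀<Lb Lb≤c') params)
      where
      Lb≤c' = m≤n⇒m≤1+n Lb≤c
      binders = ≤-refl , <-≤-trans d₀<Lb Lb≤c' , AllBelow-mono us Lb≤c' (cvars-below n n≤A)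
      params : ∀ x → T (occT x s[ var c ] ∨ occT x (var v₀)) → NotIn x (c ∷ d₀ ∷ us) → x ≢ v₀ → suc c ≤ x
      params x o x∉ x≢v₀ with occ-RecTotal (var c) x o
      ... | inj₁ p = ⊥-elim (proj₁ x∉ (T-≡ᵇ p))
      ... | inj₂ (inj₁ q) = ⊥-elim (occ-vars-notIn x us q (proj₂ (proj₂ x∉)))
      ... | inj₂ (inj₂ e) = ⊥-elim (x≢v₀ e)

    CI-below : ∀ c → Lb ≤ c → ItemBelow (suc c) (step (call c (RecTotal (var c))))
    CI-below c Lb≤c = occ-⊓⊔Eq-below (suc c) (c ∷ d₀ ∷ us) v₀ s[ var c ] (var v₀)
      (≤-refl , <-≤-trans d₀<Lb Lb≤c' , AllBelow-mono us Lb≤c' (cvars-below n n≤A)) (<-≤-trans v₀<Lb Lb≤c') below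
      where
      Lb≤c' = m≤n⇒m≤1+n Lb≤c
      below : ∀ x → T (occT x s[ var c ] ∨ occT x (var v₀)) → x < suc c
      below x o with occ-RecTotal (var c) x o
      ... | inj₁ p rewrite T-≡ᵇ {x} {c} p = ≤-refl
      ... | inj₂ (inj₁ q) = <-≤-trans (occ-vars-below Lb us x (cvars-below n n≤A) q) Lb≤c'
      ... | inj₂ (inj₂ refl) = <-≤-trans v₀<Lb Lb≤c'

    module Instances (c : Var) (Lb≤c : Lb ≤ c) where
      H H₀ Hₛ : Formula
      H = RecTotal (var c)
      H₀ = substF c (con 0) H
      Hₛ = substF c (S (var c)) H

      H₀≡ : H₀ ≡ RecTotal (con 0)
      H₀≡ = RecTotal-subst c (con 0) Lb≤c

      Hₛ≡ : Hₛ ≡ RecTotal (S (var c))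
      Hₛ≡ = RecTotal-subst c (S (var c)) Lb≤c

      private
        occ-c : ∀ x → T (occT x (var c)) → x ≡ c
        occ-c x o = T-≡ᵇ o
        occ-c' : ∀ x → T (occT x (S (var c))) → x ≡ c
        occ-c' x o with ∨⁻ (occT x (var c)) o
        ... | inj₁ a = T-≡ᵇ a

      H₀-WFf : WFf H₀
      H₀-WFf = subst WFf (sym H₀≡) (RecTotal-WFf (con 0) (λ x ()))

      H-WFf : WFf H
      H-WFf = RecTotal-WFf (var c) (λ x o → subst (Lb ≤_) (sym (occ-c x o)) Lb≤c)

      Hₛ-WFf : WFf Hₛ
      Hₛ-WFf = subst WFf (sym Hₛ≡) (RecTotal-WFf (S (var c)) (λ x o → subst (Lb ≤_) (sym (occ-c' x o)) Lb≤c))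

      H₀-below : ItemBelow c (step H₀)
      H₀-below x o = RecTotal-below (con 0) c Lb≤c (λ x ()) x (subst (λ F → T (occF x F)) H₀≡ o)

      sub-below : ItemBelow (suc c) (sub (H ∷ []) (step Hₛ ∷ []))
      sub-below x o with ∨⁻ (any (occF x) (H ∷ [])) o
      ... | inj₁ a with ∨⁻ (occF x H) a
      ... | inj₁ b = RecTotal-below (var c) (suc c) (m≤n⇒m≤1+n Lb≤c) (λ y oy → s≤s (≤-reflexive (occ-c y oy))) x b
      sub-below x o | inj₂ a with ∨⁻ (occItem x (step Hₛ)) a
      ... | inj₁ b = RecTotal-below (S (var c)) (suc c) (m≤n⇒m≤1+n Lb≤c) (λ y oy → s≤s (≤-reflexive (occ-c' y oy))) x
                       (subst (λ F → T (occF x F)) Hₛ≡ b)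

    -- H(0) by LC; the subdeduction derives H(c') from the hypothesis H(c); CI gives ⊓c H(c); LC gives Total f.
    recBlock : ∀ P c → Lb ≤ c → c < U₀ → step E ∈ P → Scoped Lb U₀ E → step (Total (n , g)) ∈ P →
      step (Total (suc (suc n) , h)) ∈ P → All (ItemBelow c) P → TotalBlock P (suc n , f) c
    recBlock P c Lb≤c c<U₀ E∈P scE g∈P h∈P P-below =
      step H₀ ∷ sub (H ∷ []) (step Hₛ ∷ []) ∷ step (call c H) ∷ step (Total (suc n , f)) ∷ [] ,
      (H₀-WFf , just-H₀ , (H-WFf ∷ []) , (Hₛ-WFf , just-Hₛ , _) ,
       (CI-WFf c Lb≤c , just-CI , (total-WFf (suc n , f) n+1≤A , just-total , _))) ,
      here refl ,
      ((λ x o → m≤n⇒m≤1+n (H₀-below x o)) ∷ sub-below ∷ CI-below c Lb≤c ∷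
       total-below (suc n , f) n+1≤A (suc c) (m≤n⇒m≤1+n Lb≤c) ∷ [])
      where
      open Instances c Lb≤c
      just-H₀ : Justified P H₀
      just-H₀ = by-LC (E ∷ Total (n , g) ∷ []) (E∈P ∷ g∈P ∷ [])
        (subst (λ F → CL12 (E ∷ Total (n , g) ∷ [] •- F)) (sym H₀≡) (total-rec-zero scE))
      just-Hₛ : Justified (step H ∷ step H₀ ∷ P) Hₛ
      just-Hₛ = by-LC (E ∷ H ∷ Total (suc (suc n) , h) ∷ []) (there (there E∈P) ∷ here refl ∷ there (there h∈P) ∷ [])
        (subst (λ F → CL12 (E ∷ H ∷ Total (suc (suc n) , h) ∷ [] •- F)) (sym Hₛ≡) (Step.total-rec-suc c Lb≤c c<U₀ scE))
      just-CI : Justified (sub (H ∷ []) (step Hₛ ∷ []) ∷ step H₀ ∷ P) (call c H)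
      just-CI = by-CI c H (step Hₛ ∷ []) [] (step H₀ ∷ P) refl (there (here refl)) ([] , refl)
        (All.map (λ below o → <-irrefl refl (below c o)) (H₀-below ∷ P-below)) []
      just-total : Justified (step (call c H) ∷ sub (H ∷ []) (step Hₛ ∷ []) ∷ step H₀ ∷ P) (Total (suc n , f))
      just-total = by-LC (call c H ∷ []) (here refl ∷ []) (total-rec-close c Lb≤c c<U₀)

  totalBlock : ∀ (Earlier : Sym → Set) s E → PRDef Earlier s E → ∀ P c → Lb ≤ c → c < U₀ → step E ∈ P → Scoped Lb U₀ E →
    (∀ s' → Earlier s' → step (Total s') ∈ P × proj₁ s' ≤ A) → proj₁ s ≤ A → All (ItemBelow c) P → TotalBlock P s c
  totalBlock _ _ E (defI g x) P c Lb≤c _ E∈P scE _ 1≤A _ = succBlock P g x c Lb≤c 1≤A E∈P scE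
  totalBlock _ (n , g) E (defII g xs d) P c Lb≤c _ E∈P scE _ n≤A _ =
    lcBlock P (n , g) c (E ∷ []) Lb≤c n≤A (E∈P ∷ []) (total-zero g xs (Distinct⇒AllDistinct xs d) n≤A scE)
  totalBlock _ (n , g) E (defIII g xs d i) P c Lb≤c _ E∈P scE _ n≤A _ =
    lcBlock P (n , g) c (E ∷ []) Lb≤c n≤A (E∈P ∷ []) (total-proj g xs (Distinct⇒AllDistinct xs d) i n≤A scE)
  totalBlock _ (n , f) E (defIV f g hs xs d g< hs<) P c Lb≤c _ E∈P scE earlier n≤A _ =
    lcBlock P (n , f) c (E ∷ List.map hypOf (compositionUses g hs)) Lb≤c n≤A
      (E∈P ∷ compositionUses-∈ P g hs (λ j → proj₁ (earlier _ (hs< j))) (proj₁ (earlier _ g<)))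
      (total-comp f g hs xs (Distinct⇒AllDistinct xs d) n≤A (proj₂ (earlier _ g<)) scE)
  totalBlock _ (suc n , f) E (defV f g h x₁ xs d g< h<) P c Lb≤c c<U₀ E∈P scE earlier _ P-below =
    RecBlock.recBlock f g h x₁ xs d (proj₂ (earlier _ h<)) P c Lb≤c c<U₀ E∈P scE
      (proj₁ (earlier _ g<)) (proj₁ (earlier _ h<)) P-below

-- Deriving Total g for every symbol g of a construction, in order

module Construction {n} {f : FunSym n} {k} {Es : Vec Formula (suc k)} (pc : PRConstruction Es (n , f))
                    (N : ℕ) (Es≤N : binderBounds (toList Es) ≤ N) where
  open PRConstruction pc

  A : ℕ
  A = aritySum gs

  open Canonical N A

  U₀ : ℕ
  U₀ = suc k + Lb

  open Derivations U₀ (m≤n+m Lb (suc k))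
  open Assembly N A U₀ (m≤n+m Lb (suc k))

  hyps : List Item
  hyps = List.map step (reverse (toList Es))

  E-closed : ∀ i x → ¬ T (freeF x (lookup Es i))
  E-closed i = PRDef-closed (defs i)

  E∈Es : ∀ i → lookup Es i ∈ toList Es
  E∈Es i = VecMemₚ.∈-toList⁺ (VecMemₚ.∈-lookup i Es)

  N<Lb : N < Lb
  N<Lb = ≤-trans (n≤1+n (suc N)) (m≤n+m (suc (suc N)) A)

  E-bound : ∀ i x → T (boundF x (lookup Es i)) → x < Lb
  E-bound i x b =
    <-≤-trans (bound<binderBound x (lookup Es i) b) (≤-trans (binderBound≤binderBounds (toList Es) (E∈Es i)) (≤-trans Es≤N (<⇒≤ N<Lb)))

  hyps-below : All (ItemBelow Lb) hyps
  hyps-below = Allₚ.map⁺ (All-ʳ++⁺ (toList Es) [] []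
    (VecAllₚ.toList⁺ (VecAllₚ.lookup⁻ (λ i → closed-below (lookup Es i) (E-closed i) (E-bound i)))))

  DerivedUpTo : ℕ → Set₁
  DerivedUpTo i = Σ (List Item) λ is → Checks hyps is ×
    (∀ j → toℕ j < i → step (Total (lookup gs j)) ∈ is ʳ++ hyps) × All (ItemBelow (i + Lb)) (is ʳ++ hyps)

  -- The i-th block may use i + Lb as the variable of its CI step: everything derived before lies below it.
  derivedUpTo : ∀ i → i ≤ suc k → DerivedUpTo i
  derivedUpTo zero _ = [] , _ , (λ j ()) , hyps-below
  derivedUpTo (suc i) i<k+1 = extend (derivedUpTo i (≤-trans (n≤1+n i) i<k+1))
    where
    j : Fin (suc k)
    j = fromℕ< i<k+1
    toℕj≡i : toℕ j ≡ i
    toℕj≡i = Finₚ.toℕ-fromℕ< i<k+1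
    extend : DerivedUpTo i → DerivedUpTo (suc i)
    extend (is , is-checks , derived , below) = add-block
      (totalBlock _ (lookup gs j) (lookup Es j) (defs j) (is ʳ++ hyps) (i + Lb) (m≤n+m Lb i) (+-monoˡ-< Lb i<k+1)
         (∈-ʳ++⁺ʳ is hyps (∈-map⁺ step (Anyₚ.reverse⁺ (E∈Es j))))
         ((λ x fx → ⊥-elim (E-closed j x fx)) , E-bound j) earlier (arity≤aritySum gs j) below)
      where
      earlier : ∀ s → (∃ λ j' → toℕ j' < toℕ j × lookup gs j' ≡ s) → step (Total s) ∈ is ʳ++ hyps × proj₁ s ≤ A
      earlier s (j' , j'<j , refl) = derived j' (subst (toℕ j' <_) toℕj≡i j'<j) , arity≤aritySum gs j'
      add-block : TotalBlock (is ʳ++ hyps) (lookup gs j) (i + Lb) → DerivedUpTo (suc i)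
      add-block (blk , blk-checks , gⱼ∈ , blk-below) =
        is ++ blk , checks-++ hyps is blk is-checks blk-checks , derived' ,
        subst (All (ItemBelow (suc i + Lb))) (sym (++-ʳ++ is))
          (All-ʳ++⁺ blk (is ʳ++ hyps) (all-ItemBelow-mono (n≤1+n (i + Lb)) below) blk-below)
        where
        derived' : ∀ j' → toℕ j' < suc i → step (Total (lookup gs j')) ∈ (is ++ blk) ʳ++ hyps
        derived' j' j'<i+1 rewrite ++-ʳ++ is {blk} {hyps} with m<1+n⇒m<n∨m≡n j'<i+1
        ... | inj₁ j'<i = ∈-ʳ++⁺ʳ blk (is ʳ++ hyps) (derived j' j'<i)
        ... | inj₂ j'≡i rewrite Finₚ.toℕ-injective {i = j'} {j = j} (trans j'≡i (sym toℕj≡i)) = gⱼ∈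

  derivation : ∀ (xs : Vec Var n) y → AllDistinct xs → NotIn y xs → AllBelow N xs → y < N →
    ∃ λ is → Checks hyps is × Last is (step (goal f xs y))
  derivation xs y dxs y∉xs xs<N y<N with derivedUpTo (suc k) ≤-refl
  ... | is , is-checks , derived , _ =
    is ++ step (goal f xs y) ∷ [] ,
    checks-++ hyps is (step (goal f xs y) ∷ []) is-checks
      (goal-WFf , by-LC (Total (n , f) ∷ []) (f∈ ∷ []) (Goal.goal-from-total f xs y n≤A dxs y∉xs xs<Lb y<Lb) , _) ,
    (is , refl)
    where
    n≤A : n ≤ A
    n≤A = subst (λ s → proj₁ s ≤ A) lastIsF (arity≤aritySum gs (fromℕ k))
    f∈ : step (Total (n , f)) ∈ is ʳ++ hyps
    f∈ = subst (λ s → step (Total s) ∈ is ʳ++ hyps) lastIsF (derived (fromℕ k) (s≤s (≤-reflexive (Finₚ.toℕ-fromℕ k))))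
    xs<Lb : AllBelow Lb xs
    xs<Lb = AllBelow-mono xs (<⇒≤ N<Lb) xs<N
    y<Lb : y < Lb
    y<Lb = <-trans y<N N<Lb
    goal-WFf : WFf (goal f xs y)
    goal-WFf = scoped∞⇒WFf (goal f xs y) (scoped∞-⊓⊔Eq Lb xs y (app f (vars xs)) (var y) xs<Lb y<Lb params)
      where
      params : ∀ x → T (occT x (app f (vars xs)) ∨ occT x (var y)) → NotIn x xs → x ≢ y → Lb ≤ x
      params x o x∉xs x≢y with ∨⁻ (occT x (app f (vars xs))) o
      ... | inj₁ a = ⊥-elim (occ-vars-notIn x xs a x∉xs)
      ... | inj₂ b = ⊥-elim (x≢y (T-≡ᵇ b))

proposition11p2 : ∀ {n} (f : FunSym n) {k} (Es : Vec Formula (suc k)) →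
    PRConstruction Es (n , f) →
    (xs : Vec Var n) → Distinct xs → (y : Var) → (∀ i → lookup xs i ≢ y) →
    CLA2⊢ (toList Es) (goal f xs y)
proposition11p2 f Es pc xs dxs y xs≢y =
  VecAllₚ.toList⁺ (VecAllₚ.lookup⁻ (λ i x fx _ → E-closed i x fx)) ,
  derivation xs y (Distinct⇒AllDistinct xs dxs) (notIn⁺ y xs (λ i e → xs≢y i (sym e)))
    (allBelow⁺ N xs (λ i → <-≤-trans (lookup<varsBound xs i) (≤-trans (m≤n+m _ (binderBounds (toList Es))) (m≤m+n _ (suc y)))))
    (m≤n+m (suc y) _)
  where
  N = binderBounds (toList Es) + varsBound xs + suc y
  open Construction pc N (≤-trans (m≤m+n _ (varsBound xs)) (m≤m+n _ (suc y)))
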